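{- Let $c\in(1/2,1)$ and let $n_0$ be a positive integer such that $cn_0$ is an integer. Suppose there is a complete geometric graph on $n_0$ points whose edge set can be partitioned into $cn_0$ plane star-forests in such a way that every vertex is the center of at least one star (component) of at least one of these star-forests. Then for every integer $k\ge 1$ there exists a complete geometric graph on $kn_0$ points whose edge set can be partitioned into $ckn_0$ plane star-forests.
   Context: A complete geometric graph on a finite point set $P\subset\mathbb{R}^2$ in general position (no three points collinear) is the complete graph with vertex set $P$ whose edges are drawn as straight line segments. A subgraph is plane if no two of its edges cross (i.e. any two of its segments meet at most in a common endpoint). A star is a connected graph on $m\ge 1$ vertices with one vertex (the center) of degree $m-1$ and all others of degree $1$; a single vertex is a star with itself as center, and for a single edge one endpoint is designated as center. A star-forest is a forest each of whose components is a star.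
   Formalization: The given complete geometric graph on $n_0$ points has rational coordinates instead of real ones, and the graph on $kn_0$ points is also taken with rational coordinates. -}

module Defs where

open import Data.Nat as ℕ using (ℕ)
open import Data.Fin using (Fin)
open import Data.Rational as ℚ using (ℚ; 0ℚ; 1ℚ; _+_; _*_; _-_; _≤_)
open import Data.Product using (Σ; ∃; _×_; _,_)
open import Data.Sum using (_⊎_)
open import Relation.Nullary using (¬_)
open import Relation.Binary.PropositionalEquality using (_≡_; _≢_)

Point : Set
Point = ℚ × ℚ

OnSegment : Point → Point → Point → Set
OnSegment (p₁ , p₂) (q₁ , q₂) (x₁ , x₂) =
  Σ ℚ λ t → (0ℚ ≤ t) × (t ≤ 1ℚ) ×
    (x₁ ≡ p₁ + t * (q₁ - p₁)) × (x₂ ≡ p₂ + t * (q₂ - p₂))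

MeetAtMostInCommonEndpoint : Point → Point → Point → Point → Set
MeetAtMostInCommonEndpoint a b c d =
  ∀ x → OnSegment a b x → OnSegment c d x →
    (x ≡ a ⊎ x ≡ b) × (x ≡ c ⊎ x ≡ d)

OnLine : ℚ → ℚ → ℚ → Point → Set
OnLine α β γ (x , y) = α * x + β * y ≡ γ

Collinear : Point → Point → Point → Set
Collinear p q r = Σ ℚ λ α → Σ ℚ λ β → Σ ℚ λ γ →
  ¬ (α ≡ 0ℚ × β ≡ 0ℚ) × OnLine α β γ p × OnLine α β γ q × OnLine α β γ r

GeneralPosition : ∀ {n} → (Fin n → Point) → Set
GeneralPosition {n} P =
  (∀ i j → i ≢ j → P i ≢ P j) ×
  (∀ i j k → i ≢ j → j ≢ k → i ≢ k → ¬ Collinear (P i) (P j) (P k))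

EdgeSet : ℕ → Set₁
EdgeSet n = Fin n → Fin n → Set

-- Isolated vertices are single-vertex stars centered at themselves;
-- for a single-edge star the center is the designated endpoint.
IsStarForestWith : ∀ {n} → EdgeSet n → (Fin n → Fin n) → Set
IsStarForestWith E cen =
  (∀ v → cen (cen v) ≡ cen v) ×
  (∀ i j → (E i j → (i ≢ j × (cen i ≡ j ⊎ cen j ≡ i))) ×
           ((i ≢ j × (cen i ≡ j ⊎ cen j ≡ i)) → E i j))

DistinctEdges : ∀ {n} → Fin n → Fin n → Fin n → Fin n → Set
DistinctEdges a b c d = ¬ ((a ≡ c × b ≡ d) ⊎ (a ≡ d × b ≡ c))

Plane : ∀ {n} → (Fin n → Point) → EdgeSet n → Set
Plane P E = ∀ a b c d → E a b → E c d → DistinctEdges a b c d →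
  MeetAtMostInCommonEndpoint (P a) (P b) (P c) (P d)

ColourClass : ∀ {n K} → (Fin n → Fin n → Fin K) → Fin K → EdgeSet n
ColourClass col f i j = (i ≢ j) × (col i j ≡ f)

-- A partition of the edge set of the complete geometric graph on P into K plane
-- star-forests, given by a (symmetric) edge colouring with K colours, each colour
-- class being a plane star-forest with center map `cen f`.
StarForestPartition : ∀ {n} → (Fin n → Point) → (K : ℕ) →
  (Fin n → Fin n → Fin K) → (Fin K → Fin n → Fin n) → Set
StarForestPartition P K col cen =
  (∀ i j → col i j ≡ col j i) ×
  (∀ f → IsStarForestWith (ColourClass col f) (cen f) × Plane P (ColourClass col f))

EveryVertexACenter : ∀ {n K} → (Fin K → Fin n → Fin n) → Set
EveryVertexACenter {n} {K} cen = ∀ (v : Fin n) → Σ (Fin K) λ f → cen f v ≡ v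

{-# OPTIONS --safe #-}
module Submission where

import Algebra.Construct.NaturalChoice.Min as Min
open import Data.Empty using (⊥; ⊥-elim)
open import Data.Fin using (Fin; toℕ)
import Data.Fin as Fin
open import Data.Fin.Properties using (*↔×; ≤-totalOrder)
import Data.Fin.Properties as Finₚ
open import Data.List using (List; []; _∷_; map)
open import Data.Nat using (ℕ; zero; suc)
import Data.Nat as ℕ
import Data.Nat.Properties as ℕₚ
open import Data.Product using (Σ; Σ-syntax; _×_; _,_; proj₁; proj₂)
import Data.Product as Product
open import Data.Product.Properties using (≡-dec)
open import Data.Rational using (ℚ; 0ℚ)
open import Data.Rational.Solver using (module +-*-Solver)
open import Data.Sum using (_⊎_; inj₁; inj₂; swap)
import Data.Sum as Sum
open import Function using (_∘_; _↔_; Inverse; Injection)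
open import Function.Properties.Inverse using (↔⇒↣)
open import Relation.Binary.Definitions using (DecidableEquality; tri<; tri≈; tri>)
open import Relation.Binary.PropositionalEquality
open import Relation.Nullary using (¬_; Dec; yes; no)
open import Relation.Nullary.Decidable using (¬?; _×-dec_)

open import Defs

-- Each point p of the drawing is replaced by k copies close to p, and each plane star-forest f by k copies
-- (a , f): in copy a, every copy of a leaf of f is joined to copy a of its centre. This leaves the edges between
-- copies of one vertex i uncovered; they go to a colour f in which i is a centre, copy a of i becoming, in copy a
-- of f, also the centre of the later copies of i. The resulting k·m colour classes are star-forests, and for
-- small ε they are plane: the original drawing is robust (non-collinear triples, and disjoint leaf edges of
-- different stars, are certified by strict signs of orientations), and every sign needed after perturbing is the
-- leading coefficient of a polynomial in ε.

module RationalArithmetic where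

  open import Data.Rational
  open import Data.Rational.Properties
  open import Algebra.Properties.Group +-0-group using (x∙y⁻¹≈ε⇒x≈y; ⁻¹-involutive)

  private
    variable
      p q r : ℚ

  pos*pos⇒0< : 0ℚ < p → 0ℚ < q → 0ℚ < p * q
  pos*pos⇒0< {p} {q} 0<p 0<q = positive⁻¹ (p * q) {{pos*pos⇒pos p {{positive 0<p}} q {{positive 0<q}}}}

  neg*neg⇒0< : p < 0ℚ → q < 0ℚ → 0ℚ < p * q
  neg*neg⇒0< {p} {q} p<0 q<0 = positive⁻¹ (p * q) {{neg*neg⇒pos p {{negative p<0}} q {{negative q<0}}}}

  nonNeg*nonNeg⇒0≤ : 0ℚ ≤ p → 0ℚ ≤ q → 0ℚ ≤ p * q
  nonNeg*nonNeg⇒0≤ {p} {q} 0≤p 0≤q =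
    nonNegative⁻¹ (p * q) {{nonNeg*nonNeg⇒nonNeg p {{nonNegative 0≤p}} q {{nonNegative 0≤q}}}}

  p≢0⇒0<p*p : p ≢ 0ℚ → 0ℚ < p * p
  p≢0⇒0<p*p {p} p≢0 with <-cmp p 0ℚ
  ... | tri< p<0 _ _ = neg*neg⇒0< p<0 p<0
  ... | tri≈ _ p≡0 _ = ⊥-elim (p≢0 p≡0)
  ... | tri> _ _ 0<p = pos*pos⇒0< 0<p 0<p

  0<p⇒p≢0 : 0ℚ < p → p ≢ 0ℚ
  0<p⇒p≢0 0<p p≡0 = <⇒≢ 0<p (sym p≡0)

  p<q⇒0<q-p : p < q → 0ℚ < q - p
  p<q⇒0<q-p {p} {q} p<q = subst (_< q - p) (+-inverseʳ p) (+-monoˡ-< (- p) p<q)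

  p-q≡0⇒p≡q : p - q ≡ 0ℚ → p ≡ q
  p-q≡0⇒p≡q = x∙y⁻¹≈ε⇒x≈y _ _

  *-cancelˡ-≡ : p ≢ 0ℚ → p * q ≡ p * r → q ≡ r
  *-cancelˡ-≡ {p} {q} {r} p≢0 pq≡pr = begin
    q               ≡⟨ sym (*-identityˡ q) ⟩
    1ℚ * q          ≡⟨ cong (_* q) (sym p⁻¹p≡1) ⟩
    (p⁻¹ * p) * q   ≡⟨ *-assoc p⁻¹ p q ⟩
    p⁻¹ * (p * q)   ≡⟨ cong (p⁻¹ *_) pq≡pr ⟩
    p⁻¹ * (p * r)   ≡⟨ sym (*-assoc p⁻¹ p r) ⟩
    (p⁻¹ * p) * r   ≡⟨ cong (_* r) p⁻¹p≡1 ⟩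
    1ℚ * r          ≡⟨ *-identityˡ r ⟩
    r               ∎
    where
    open ≡-Reasoning
    instance _ = ≢-nonZero p≢0
    p⁻¹ = 1/ p
    p⁻¹p≡1 = *-inverseˡ p

  p*q≡0⇒q≡0 : p ≢ 0ℚ → p * q ≡ 0ℚ → q ≡ 0ℚ
  p*q≡0⇒q≡0 {p} p≢0 pq≡0 = *-cancelˡ-≡ p≢0 (trans pq≡0 (sym (*-zeroʳ p)))

  ≢0*≢0⇒≢0 : p ≢ 0ℚ → q ≢ 0ℚ → p * q ≢ 0ℚ
  ≢0*≢0⇒≢0 p≢0 q≢0 pq≡0 = q≢0 (p*q≡0⇒q≡0 p≢0 pq≡0)

  ∣p∣<q⇒0<q+p : ∣ p ∣ < q → 0ℚ < q + p
  ∣p∣<q⇒0<q+p {p} {q} ∣p∣<q with ∣p∣≡p∨∣p∣≡-p p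
  ... | inj₁ ∣p∣≡p =
    subst (_< q + p) (+-identityʳ 0ℚ) (+-mono-<-≤ (≤-<-trans (0≤∣p∣ p) ∣p∣<q) (subst (0ℚ ≤_) ∣p∣≡p (0≤∣p∣ p)))
  ... | inj₂ ∣p∣≡-p =
    subst (0ℚ <_) (cong (q +_) (⁻¹-involutive p)) (p<q⇒0<q-p (subst (_< q) ∣p∣≡-p ∣p∣<q))

  p≤q⇒0≤q-p : p ≤ q → 0ℚ ≤ q - p
  p≤q⇒0≤q-p {p} {q} p≤q = subst (_≤ q - p) (+-inverseʳ p) (+-monoˡ-≤ (- p) p≤q)

  0≤p⇒q-p≤q : 0ℚ ≤ p → q - p ≤ q
  0≤p⇒q-p≤q {p} {q} 0≤p = subst (q - p ≤_) (+-identityʳ q) (+-monoʳ-≤ q (neg-antimono-≤ 0≤p))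

  p≢q⇒p-q≢0 : p ≢ q → p - q ≢ 0ℚ
  p≢q⇒p-q≢0 p≢q p-q≡0 = p≢q (p-q≡0⇒p≡q p-q≡0)

open RationalArithmetic

module SmallParameter where

  open import Data.Rational
  open import Data.Rational.Properties
  open +-*-Solver

  Eventually : (ℚ → Set) → Set
  Eventually P = Σ[ δ ∈ ℚ ] 0ℚ < δ × (∀ ε → 0ℚ < ε → ε ≤ δ → P ε)

  module _ {P Q : ℚ → Set} where

    eventually-map : (∀ ε → 0ℚ < ε → P ε → Q ε) → Eventually P → Eventually Q
    eventually-map f (δ , 0<δ , h) = δ , 0<δ , λ ε 0<ε ε≤δ → f ε 0<ε (h ε 0<ε ε≤δ)

    eventually-× : Eventually P → Eventually Q → Eventually (λ ε → P ε × Q ε)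
    eventually-× (δ₁ , 0<δ₁ , h₁) (δ₂ , 0<δ₂ , h₂) = δ₁ ⊓ δ₂ , 0<δ₁⊓δ₂ , λ ε 0<ε ε≤δ →
      h₁ ε 0<ε (≤-trans ε≤δ (p⊓q≤p δ₁ δ₂)) , h₂ ε 0<ε (≤-trans ε≤δ (p⊓q≤q δ₁ δ₂))
      where
      0<δ₁⊓δ₂ : 0ℚ < δ₁ ⊓ δ₂
      0<δ₁⊓δ₂ with ⊓-sel δ₁ δ₂
      ... | inj₁ ≡δ₁ = subst (0ℚ <_) (sym ≡δ₁) 0<δ₁
      ... | inj₂ ≡δ₂ = subst (0ℚ <_) (sym ≡δ₂) 0<δ₂

  eventually-always : {P : ℚ → Set} → (∀ ε → 0ℚ < ε → P ε) → Eventually P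
  eventually-always h = 1ℚ , positive⁻¹ 1ℚ , λ ε 0<ε _ → h ε 0<ε

  eventually-→ : {A : Set} {P : ℚ → Set} → Dec A → (A → Eventually P) → Eventually (λ ε → A → P ε)
  eventually-→ (yes a) h = eventually-map (λ _ _ p _ → p) (h a)
  eventually-→ (no ¬a) _ = eventually-always (λ _ _ a → ⊥-elim (¬a a))

  eventually-∀Fin : ∀ n {P : Fin n → ℚ → Set} → (∀ i → Eventually (P i)) → Eventually (λ ε → ∀ i → P i ε)
  eventually-∀Fin zero    h = eventually-always (λ _ _ ())
  eventually-∀Fin (suc n) h = eventually-map (λ { _ _ (p₀ , pₛ) Fin.zero → p₀ ; _ _ (p₀ , pₛ) (Fin.suc i) → pₛ i })
    (eventually-× (h Fin.zero) (eventually-∀Fin n (h ∘ Fin.suc)))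

  eventually-∀Fin× : ∀ k n {P : Fin k × Fin n → ℚ → Set} → (∀ x → Eventually (P x)) →
    Eventually (λ ε → ∀ x → P x ε)
  eventually-∀Fin× k n h = eventually-map (λ _ _ p (t , i) → p t i)
    (eventually-∀Fin k (λ t → eventually-∀Fin n (λ i → h (t , i))))

  eval : List ℚ → ℚ → ℚ
  eval []       ε = 0ℚ
  eval (c ∷ cs) ε = c + ε * eval cs ε

  eval-scale : ∀ σ cs ε → eval (map (σ *_) cs) ε ≡ σ * eval cs ε
  eval-scale σ []       ε = sym (*-zeroʳ σ)
  eval-scale σ (c ∷ cs) ε = begin
    σ * c + ε * eval (map (σ *_) cs) ε  ≡⟨ cong (λ v → σ * c + ε * v) (eval-scale σ cs ε) ⟩
    σ * c + ε * (σ * eval cs ε)         ≡⟨ solve 4 (λ σ c ε v → σ :* c :+ ε :* (σ :* v) := σ :* (c :+ ε :* v))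
                                                 refl σ c ε (eval cs ε) ⟩
    σ * (c + ε * eval cs ε)             ∎
    where open ≡-Reasoning

  coefficientBound : List ℚ → ℚ
  coefficientBound []       = 0ℚ
  coefficientBound (c ∷ cs) = ∣ c ∣ + coefficientBound cs

  coefficientBound-nonNeg : ∀ cs → 0ℚ ≤ coefficientBound cs
  coefficientBound-nonNeg []       = ≤-refl
  coefficientBound-nonNeg (c ∷ cs) = subst (_≤ coefficientBound (c ∷ cs)) (+-identityˡ 0ℚ)
    (+-mono-≤ (0≤∣p∣ c) (coefficientBound-nonNeg cs))

  ∣eval∣≤coefficientBound : ∀ cs ε → 0ℚ ≤ ε → ε ≤ 1ℚ → ∣ eval cs ε ∣ ≤ coefficientBound cs
  ∣eval∣≤coefficientBound []       ε _   _   = ≤-refl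
  ∣eval∣≤coefficientBound (c ∷ cs) ε 0≤ε ε≤1 =
    ≤-trans (∣p+q∣≤∣p∣+∣q∣ c (ε * v)) (+-monoʳ-≤ ∣ c ∣ ∣εv∣≤B)
    where
    v = eval cs ε
    ∣εv∣≤B : ∣ ε * v ∣ ≤ coefficientBound cs
    ∣εv∣≤B = begin
      ∣ ε * v ∣      ≡⟨ ∣p*q∣≡∣p∣*∣q∣ ε v ⟩
      ∣ ε ∣ * ∣ v ∣  ≡⟨ cong (_* ∣ v ∣) (0≤p⇒∣p∣≡p 0≤ε) ⟩
      ε * ∣ v ∣      ≤⟨ *-monoʳ-≤-nonNeg ∣ v ∣ {{∣-∣-nonNeg v}} ε≤1 ⟩
      1ℚ * ∣ v ∣     ≡⟨ *-identityˡ ∣ v ∣ ⟩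
      ∣ v ∣          ≤⟨ ∣eval∣≤coefficientBound cs ε 0≤ε ε≤1 ⟩
      coefficientBound cs ∎
      where open ≤-Reasoning

  eventually-≤ : ∀ {δ} → 0ℚ < δ → Eventually (_≤ δ)
  eventually-≤ {δ} 0<δ = δ , 0<δ , λ _ _ ε≤δ → ε≤δ

  eventually-0<eval-∷ : ∀ c cs → 0ℚ < c → Eventually (λ ε → 0ℚ < eval (c ∷ cs) ε)
  eventually-0<eval-∷ c cs 0<c =
    eventually-map (λ ε 0<ε (ε≤1 , ε≤c/K) → ∣p∣<q⇒0<q+p (∣εv∣<c ε 0<ε ε≤1 ε≤c/K))
      (eventually-× (eventually-≤ (positive⁻¹ 1ℚ)) (eventually-≤ (pos*pos⇒0< 0<c (positive⁻¹ (1/ K)))))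
    where
    B = coefficientBound cs
    K = B + 1ℚ
    B<K : B < K
    B<K = subst (_< K) (+-identityʳ B) (+-monoʳ-< B (positive⁻¹ 1ℚ))
    instance
      K-pos : Positive K
      K-pos = positive (≤-<-trans (coefficientBound-nonNeg cs) B<K)
      K-nonZero : NonZero K
      K-nonZero = pos⇒nonZero K
      K⁻¹-pos : Positive (1/ K)
      K⁻¹-pos = 1/pos⇒pos K
    ∣εv∣<c : ∀ ε → 0ℚ < ε → ε ≤ 1ℚ → ε ≤ c * 1/ K → ∣ ε * eval cs ε ∣ < c
    ∣εv∣<c ε 0<ε ε≤1 ε≤c/K = begin-strict
      ∣ ε * v ∣       ≡⟨ ∣p*q∣≡∣p∣*∣q∣ ε v ⟩
      ∣ ε ∣ * ∣ v ∣   ≡⟨ cong (_* ∣ v ∣) (0≤p⇒∣p∣≡p (<⇒≤ 0<ε)) ⟩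
      ε * ∣ v ∣       ≤⟨ *-monoˡ-≤-nonNeg ε {{nonNegative (<⇒≤ 0<ε)}}
                           (∣eval∣≤coefficientBound cs ε (<⇒≤ 0<ε) ε≤1) ⟩
      ε * B           <⟨ *-monoʳ-<-pos ε {{positive 0<ε}} B<K ⟩
      ε * K           ≤⟨ *-monoʳ-≤-nonNeg K {{pos⇒nonNeg K}} ε≤c/K ⟩
      c * 1/ K * K    ≡⟨ *-assoc c (1/ K) K ⟩
      c * (1/ K * K)  ≡⟨ cong (c *_) (*-inverseˡ K) ⟩
      c * 1ℚ          ≡⟨ *-identityʳ c ⟩
      c               ∎
      where
      open ≤-Reasoning
      v = eval cs ε

  data Leading (P : ℚ → Set) : List ℚ → Set where
    here : ∀ {c cs} → P c → Leading P (c ∷ cs)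
    skip : ∀ {c cs} → c ≡ 0ℚ → Leading P cs → Leading P (c ∷ cs)

  eventually-0<eval : ∀ cs → Leading (0ℚ <_) cs → Eventually (λ ε → 0ℚ < eval cs ε)
  eventually-0<eval (c ∷ cs) (here 0<c) = eventually-0<eval-∷ c cs 0<c
  eventually-0<eval (_ ∷ cs) (skip refl l) = eventually-map
    (λ ε 0<ε 0<v → subst (0ℚ <_) (sym (+-identityˡ (ε * eval cs ε))) (pos*pos⇒0< 0<ε 0<v)) (eventually-0<eval cs l)

  eventually-eval≢0 : ∀ cs → Leading (_≢ 0ℚ) cs → Eventually (λ ε → eval cs ε ≢ 0ℚ)
  eventually-eval≢0 (c ∷ cs) (here c≢0) = eventually-map
    (λ ε _ 0<cv v≡0 → 0<p⇒p≢0 0<cv (trans (eval-scale c (c ∷ cs) ε) (trans (cong (c *_) v≡0) (*-zeroʳ c))))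
    (eventually-0<eval-∷ (c * c) (map (c *_) cs) (p≢0⇒0<p*p c≢0))
  eventually-eval≢0 (_ ∷ cs) (skip refl l) = eventually-map
    (λ ε 0<ε v≢0 εv≡0 → v≢0 (p*q≡0⇒q≡0 (0<p⇒p≢0 0<ε) (trans (sym (+-identityˡ (ε * eval cs ε))) εv≡0)))
    (eventually-eval≢0 cs l)

  eventually-0<σ*eval : ∀ σ cs → Leading (0ℚ <_) (map (σ *_) cs) → Eventually (λ ε → 0ℚ < σ * eval cs ε)
  eventually-0<σ*eval σ cs l =
    eventually-map (λ ε _ → subst (0ℚ <_) (eval-scale σ cs ε)) (eventually-0<eval (map (σ *_) cs) l)

  eventually-witness : {P : ℚ → Set} → Eventually P → Σ[ ε ∈ ℚ ] P ε
  eventually-witness (δ , 0<δ , h) = δ , h δ 0<δ ≤-refl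

open SmallParameter

module Orientation where

  open import Data.Rational
  open import Data.Rational.Properties
  open import Algebra.Properties.Group +-0-group using (⁻¹-involutive)
  open +-*-Solver

  -- orient in the syntax of the ring solver, so that identities between orientations can be stated as such.
  orientᴾ : ∀ {n} → Polynomial n × Polynomial n → Polynomial n × Polynomial n → Polynomial n × Polynomial n →
    Polynomial n
  orientᴾ (a₁ , a₂) (b₁ , b₂) (c₁ , c₂) = (b₁ :- a₁) :* (c₂ :- a₂) :- (b₂ :- a₂) :* (c₁ :- a₁)

  orient : Point → Point → Point → ℚ
  orient (a₁ , a₂) (b₁ , b₂) (c₁ , c₂) = (b₁ - a₁) * (c₂ - a₂) - (b₂ - a₂) * (c₁ - a₁)

  orient-rotate : ∀ a b c → orient a b c ≡ orient b c a
  orient-rotate (a₁ , a₂) (b₁ , b₂) (c₁ , c₂) = solve 6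
    (λ a₁ a₂ b₁ b₂ c₁ c₂ → orientᴾ (a₁ , a₂) (b₁ , b₂) (c₁ , c₂) := orientᴾ (b₁ , b₂) (c₁ , c₂) (a₁ , a₂))
    refl a₁ a₂ b₁ b₂ c₁ c₂

  orthogonal⇒det≡0 : ∀ {α β u₁ u₂ v₁ v₂} → ¬ (α ≡ 0ℚ × β ≡ 0ℚ) →
    α * u₁ + β * u₂ ≡ 0ℚ → α * v₁ + β * v₂ ≡ 0ℚ → u₁ * v₂ - u₂ * v₁ ≡ 0ℚ
  orthogonal⇒det≡0 {α} {β} {u₁} {u₂} {v₁} {v₂} αβ≢0 u⊥ v⊥ with α ≟ 0ℚ | β ≟ 0ℚ
  ... | no α≢0 | _ = p*q≡0⇒q≡0 α≢0 (begin
    α * (u₁ * v₂ - u₂ * v₁)                             ≡⟨ solve 6 (λ α β u₁ u₂ v₁ v₂ →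
         α :* (u₁ :* v₂ :- u₂ :* v₁) := v₂ :* (α :* u₁ :+ β :* u₂) :- u₂ :* (α :* v₁ :+ β :* v₂))
         refl α β u₁ u₂ v₁ v₂ ⟩
    v₂ * (α * u₁ + β * u₂) - u₂ * (α * v₁ + β * v₂)     ≡⟨ cong₂ (λ x y → v₂ * x - u₂ * y) u⊥ v⊥ ⟩
    v₂ * 0ℚ - u₂ * 0ℚ                                   ≡⟨ solve 2 (λ u₂ v₂ →
         v₂ :* con 0ℚ :- u₂ :* con 0ℚ := con 0ℚ) refl u₂ v₂ ⟩
    0ℚ                                                  ∎)
    where open ≡-Reasoning
  ... | yes α≡0 | yes β≡0 = ⊥-elim (αβ≢0 (α≡0 , β≡0))
  ... | yes _ | no β≢0 = p*q≡0⇒q≡0 β≢0 (begin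
    β * (u₁ * v₂ - u₂ * v₁)                             ≡⟨ solve 6 (λ α β u₁ u₂ v₁ v₂ →
         β :* (u₁ :* v₂ :- u₂ :* v₁) := u₁ :* (α :* v₁ :+ β :* v₂) :- v₁ :* (α :* u₁ :+ β :* u₂))
         refl α β u₁ u₂ v₁ v₂ ⟩
    u₁ * (α * v₁ + β * v₂) - v₁ * (α * u₁ + β * u₂)     ≡⟨ cong₂ (λ x y → u₁ * x - v₁ * y) v⊥ u⊥ ⟩
    u₁ * 0ℚ - v₁ * 0ℚ                                   ≡⟨ solve 2 (λ u₁ v₁ →
         u₁ :* con 0ℚ :- v₁ :* con 0ℚ := con 0ℚ) refl u₁ v₁ ⟩
    0ℚ                                                  ∎)
    where open ≡-Reasoning

  onLine-difference : ∀ α β {γ} p₁ p₂ q₁ q₂ → OnLine α β γ (p₁ , p₂) → OnLine α β γ (q₁ , q₂) →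
    α * (q₁ - p₁) + β * (q₂ - p₂) ≡ 0ℚ
  onLine-difference α β {γ} p₁ p₂ q₁ q₂ onP onQ = begin
    α * (q₁ - p₁) + β * (q₂ - p₂)          ≡⟨ solve 6 (λ α β p₁ p₂ q₁ q₂ →
         α :* (q₁ :- p₁) :+ β :* (q₂ :- p₂) := (α :* q₁ :+ β :* q₂) :- (α :* p₁ :+ β :* p₂))
         refl α β p₁ p₂ q₁ q₂ ⟩
    (α * q₁ + β * q₂) - (α * p₁ + β * p₂)  ≡⟨ cong₂ _-_ onQ onP ⟩
    γ - γ                                  ≡⟨ +-inverseʳ γ ⟩
    0ℚ                                     ∎
    where open ≡-Reasoning

  collinear⇒orient≡0 : ∀ p q r → Collinear p q r → orient p q r ≡ 0ℚ
  collinear⇒orient≡0 (p₁ , p₂) (q₁ , q₂) (r₁ , r₂) (α , β , _ , αβ≢0 , onP , onQ , onR) =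
    orthogonal⇒det≡0 αβ≢0 (onLine-difference α β p₁ p₂ q₁ q₂ onP onQ) (onLine-difference α β p₁ p₂ r₁ r₂ onP onR)

  orient≡0⇒collinear : ∀ p q r → p ≢ q → orient p q r ≡ 0ℚ → Collinear p q r
  orient≡0⇒collinear (p₁ , p₂) (q₁ , q₂) (r₁ , r₂) p≢q pqr≡0 =
    q₂ - p₂ , p₁ - q₁ , γ , αβ≢0 , refl , onQ , onR
    where
    γ = (q₂ - p₂) * p₁ + (p₁ - q₁) * p₂
    αβ≢0 : ¬ (q₂ - p₂ ≡ 0ℚ × p₁ - q₁ ≡ 0ℚ)
    αβ≢0 (α≡0 , β≡0) = p≢q (cong₂ _,_ (p-q≡0⇒p≡q β≡0) (sym (p-q≡0⇒p≡q α≡0)))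
    onQ : (q₂ - p₂) * q₁ + (p₁ - q₁) * q₂ ≡ γ
    onQ = solve 4 (λ p₁ p₂ q₁ q₂ → (q₂ :- p₂) :* q₁ :+ (p₁ :- q₁) :* q₂ := (q₂ :- p₂) :* p₁ :+ (p₁ :- q₁) :* p₂)
      refl p₁ p₂ q₁ q₂
    onR : (q₂ - p₂) * r₁ + (p₁ - q₁) * r₂ ≡ γ
    onR = begin
      (q₂ - p₂) * r₁ + (p₁ - q₁) * r₂  ≡⟨ solve 6 (λ p₁ p₂ q₁ q₂ r₁ r₂ →
           (q₂ :- p₂) :* r₁ :+ (p₁ :- q₁) :* r₂
             := ((q₂ :- p₂) :* p₁ :+ (p₁ :- q₁) :* p₂) :- orientᴾ (p₁ , p₂) (q₁ , q₂) (r₁ , r₂))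
           refl p₁ p₂ q₁ q₂ r₁ r₂ ⟩
      γ - orient (p₁ , p₂) (q₁ , q₂) (r₁ , r₂)  ≡⟨ cong (λ o → γ - o) pqr≡0 ⟩
      γ - 0ℚ                                    ≡⟨ +-identityʳ γ ⟩
      γ                                         ∎
      where open ≡-Reasoning

  onSegment-sym : ∀ p q x → OnSegment p q x → OnSegment q p x
  onSegment-sym (p₁ , p₂) (q₁ , q₂) (x₁ , x₂) (t , 0≤t , t≤1 , x₁≡ , x₂≡) =
    1ℚ - t , p≤q⇒0≤q-p t≤1 , 0≤p⇒q-p≤q 0≤t , trans x₁≡ (reverse p₁ q₁) , trans x₂≡ (reverse p₂ q₂)
    where
    reverse : ∀ p q → p + t * (q - p) ≡ q + (1ℚ - t) * (p - q)
    reverse p q = solve 3 (λ p q t → p :+ t :* (q :- p) := q :+ (con 1ℚ :- t) :* (p :- q)) refl p q t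

  orient-onSegment : ∀ a b x → OnSegment a b x → orient a b x ≡ 0ℚ
  orient-onSegment (a₁ , a₂) (b₁ , b₂) _ (t , _ , _ , refl , refl) = solve 5
    (λ a₁ a₂ b₁ b₂ t → orientᴾ (a₁ , a₂) (b₁ , b₂) (a₁ :+ t :* (b₁ :- a₁) , a₂ :+ t :* (b₂ :- a₂)) := con 0ℚ)
    refl a₁ a₂ b₁ b₂ t

  orient-onSegment-affine : ∀ a b c d x → (x∈cd : OnSegment c d x) → let s = proj₁ x∈cd in
    orient a b x ≡ (1ℚ - s) * orient a b c + s * orient a b d
  orient-onSegment-affine (a₁ , a₂) (b₁ , b₂) (c₁ , c₂) (d₁ , d₂) _ (s , _ , _ , refl , refl) = solve 9
    (λ a₁ a₂ b₁ b₂ c₁ c₂ d₁ d₂ s → let a = (a₁ , a₂) ; b = (b₁ , b₂) in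
       orientᴾ a b (c₁ :+ s :* (d₁ :- c₁) , c₂ :+ s :* (d₂ :- c₂))
         := (con 1ℚ :- s) :* orientᴾ a b (c₁ , c₂) :+ s :* orientᴾ a b (d₁ , d₂))
    refl a₁ a₂ b₁ b₂ c₁ c₂ d₁ d₂ s

  0<convex-combination : ∀ {s p q} → 0ℚ ≤ s → s ≤ 1ℚ → 0ℚ < p → 0ℚ < q → 0ℚ < (1ℚ - s) * p + s * q
  0<convex-combination {s} {p} {q} 0≤s s≤1 0<p 0<q with <-cmp s 1ℚ
  ... | tri< s<1 _ _ = subst (_< (1ℚ - s) * p + s * q) (+-identityʳ 0ℚ)
          (+-mono-<-≤ (pos*pos⇒0< (p<q⇒0<q-p s<1) 0<p) (nonNeg*nonNeg⇒0≤ 0≤s (<⇒≤ 0<q)))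
  ... | tri≈ _ refl _ = subst (0ℚ <_) (solve 2 (λ p q → q := (con 1ℚ :- con 1ℚ) :* p :+ con 1ℚ :* q) refl p q) 0<q
  ... | tri> _ _ s>1 = ⊥-elim (<-irrefl refl (<-≤-trans s>1 s≤1))

  record SameSide (a b c d : Point) : Set where
    constructor sameSide
    field
      σ      : ℚ
      c-side : 0ℚ < σ * orient a b c
      d-side : 0ℚ < σ * orient a b d

  sameSide-of-orient≢0 : ∀ a b c → orient a b c ≢ 0ℚ → SameSide a b c c
  sameSide-of-orient≢0 a b c abc≢0 = sameSide (orient a b c) (p≢0⇒0<p*p abc≢0) (p≢0⇒0<p*p abc≢0)

  Separated : Point → Point → Point → Point → Set
  Separated a b c d = SameSide a b c d ⊎ SameSide c d a b

  sameSide⇒disjoint : ∀ {a b c d x} → SameSide a b c d → OnSegment a b x → OnSegment c d x → ⊥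
  sameSide⇒disjoint {a} {b} {c} {d} {x} (sameSide σ 0<σabc 0<σabd) x∈ab x∈cd@(s , 0≤s , s≤1 , _) =
    <-irrefl (sym σabx≡0) (subst (0ℚ <_) mix≡σabx (0<convex-combination 0≤s s≤1 0<σabc 0<σabd))
    where
    open ≡-Reasoning
    mix≡σabx : (1ℚ - s) * (σ * orient a b c) + s * (σ * orient a b d) ≡ σ * orient a b x
    mix≡σabx = begin
      (1ℚ - s) * (σ * orient a b c) + s * (σ * orient a b d)
        ≡⟨ solve 4 (λ s σ u v → (con 1ℚ :- s) :* (σ :* u) :+ s :* (σ :* v) := σ :* ((con 1ℚ :- s) :* u :+ s :* v))
             refl s σ (orient a b c) (orient a b d) ⟩
      σ * ((1ℚ - s) * orient a b c + s * orient a b d)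
        ≡⟨ cong (σ *_) (sym (orient-onSegment-affine a b c d x x∈cd)) ⟩
      σ * orient a b x ∎
    σabx≡0 : σ * orient a b x ≡ 0ℚ
    σabx≡0 = trans (cong (σ *_) (orient-onSegment a b x x∈ab)) (*-zeroʳ σ)

  separated⇒meetAtMostInCommonEndpoint : ∀ {a b c d} → Separated a b c d → MeetAtMostInCommonEndpoint a b c d
  separated⇒meetAtMostInCommonEndpoint (inj₁ abcd) x x∈ab x∈cd = ⊥-elim (sameSide⇒disjoint abcd x∈ab x∈cd)
  separated⇒meetAtMostInCommonEndpoint (inj₂ cdab) x x∈ab x∈cd = ⊥-elim (sameSide⇒disjoint cdab x∈cd x∈ab)

  onSegments-from-common-point : ∀ c x y z → orient c x y ≢ 0ℚ → OnSegment c x z → OnSegment c y z → z ≡ c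
  onSegments-from-common-point (c₁ , c₂) (x₁ , x₂) (y₁ , y₂) _ cxy≢0 z∈cx (s , _ , _ , refl , refl) =
    cong₂ _,_ (stays c₁ y₁) (stays c₂ y₂)
    where
    z = (c₁ + s * (y₁ - c₁) , c₂ + s * (y₂ - c₂))
    cxz≡cxy*s : orient (c₁ , c₂) (x₁ , x₂) z ≡ orient (c₁ , c₂) (x₁ , x₂) (y₁ , y₂) * s
    cxz≡cxy*s = solve 7 (λ c₁ c₂ x₁ x₂ y₁ y₂ s → let c = (c₁ , c₂) ; x = (x₁ , x₂) in
        orientᴾ c x (c₁ :+ s :* (y₁ :- c₁) , c₂ :+ s :* (y₂ :- c₂)) := orientᴾ c x (y₁ , y₂) :* s)
      refl c₁ c₂ x₁ x₂ y₁ y₂ s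
    s≡0 : s ≡ 0ℚ
    s≡0 = p*q≡0⇒q≡0 cxy≢0 (trans (sym cxz≡cxy*s) (orient-onSegment (c₁ , c₂) (x₁ , x₂) z z∈cx))
    stays : ∀ c y → c + s * (y - c) ≡ c
    stays c y = trans (cong (λ s → c + s * (y - c)) s≡0) (solve 2 (λ c y → c :+ con 0ℚ :* (y :- c) := c) refl c y)

  fraction-in-unit : ∀ {p q} → 0ℚ < p → 0ℚ < q → Σ[ t ∈ ℚ ] t * (p + q) ≡ p × 0ℚ ≤ t × t ≤ 1ℚ
  fraction-in-unit {p} {q} 0<p 0<q =
    p * 1/ (p + q) , t[p+q]≡p , nonNeg*nonNeg⇒0≤ (<⇒≤ 0<p) (<⇒≤ (positive⁻¹ (1/ (p + q)))) , t≤1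
    where
    instance
      p+q-pos : Positive (p + q)
      p+q-pos = positive (subst (_< p + q) (+-identityʳ 0ℚ) (+-mono-< 0<p 0<q))
      p+q-nonZero : NonZero (p + q)
      p+q-nonZero = pos⇒nonZero (p + q)
      p+q⁻¹-pos : Positive (1/ (p + q))
      p+q⁻¹-pos = 1/pos⇒pos (p + q)
    t[p+q]≡p : p * 1/ (p + q) * (p + q) ≡ p
    t[p+q]≡p = trans (*-assoc p _ _) (trans (cong (p *_) (*-inverseˡ (p + q))) (*-identityʳ p))
    t≤1 : p * 1/ (p + q) ≤ 1ℚ
    t≤1 = begin
      p * 1/ (p + q)        ≤⟨ *-monoʳ-≤-nonNeg (1/ (p + q)) {{pos⇒nonNeg (1/ (p + q))}} p≤p+q ⟩
      (p + q) * 1/ (p + q)  ≡⟨ *-inverseʳ (p + q) ⟩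
      1ℚ                    ∎
      where
      open ≤-Reasoning
      p≤p+q = subst (_≤ p + q) (+-identityʳ p) (+-monoʳ-≤ p (<⇒≤ 0<q))

  interpolation-root : ∀ {p q} → p * q < 0ℚ → Σ[ t ∈ ℚ ] t * (p - q) ≡ p × 0ℚ ≤ t × t ≤ 1ℚ
  interpolation-root {p} {q} pq<0 with <-cmp p 0ℚ | <-cmp q 0ℚ
  ... | tri≈ _ p≡0 _  | _             = ⊥-elim (<-irrefl (trans (cong (_* q) p≡0) (*-zeroˡ q)) pq<0)
  ... | _             | tri≈ _ q≡0 _  = ⊥-elim (<-irrefl (trans (cong (p *_) q≡0) (*-zeroʳ p)) pq<0)
  ... | tri> _ _ 0<p  | tri> _ _ 0<q  = ⊥-elim (<-asym pq<0 (pos*pos⇒0< 0<p 0<q))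
  ... | tri< p<0 _ _  | tri< q<0 _ _  = ⊥-elim (<-asym pq<0 (neg*neg⇒0< p<0 q<0))
  ... | tri> _ _ 0<p  | tri< q<0 _ _  = fraction-in-unit 0<p (neg-antimono-< q<0)
  ... | tri< p<0 _ _  | tri> _ _ 0<q  = negate (fraction-in-unit (neg-antimono-< p<0) 0<q)
    where
    negate : Σ[ t ∈ ℚ ] t * (- p + q) ≡ - p × 0ℚ ≤ t × t ≤ 1ℚ → Σ[ t ∈ ℚ ] t * (p - q) ≡ p × 0ℚ ≤ t × t ≤ 1ℚ
    negate (t , t[-p+q]≡-p , t∈[0,1]) = t , t[p-q]≡p , t∈[0,1]
      where
      open ≡-Reasoning
      t[p-q]≡p : t * (p - q) ≡ p
      t[p-q]≡p = begin
        t * (p - q)        ≡⟨ solve 3 (λ t p q → t :* (p :- q) := :- (t :* (:- p :+ q))) refl t p q ⟩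
        - (t * (- p + q))  ≡⟨ cong -_ t[-p+q]≡-p ⟩
        - (- p)            ≡⟨ ⁻¹-involutive p ⟩
        p                  ∎

  -- In the last two components both sides are (orient c d a − orient c d b) · x for the intersection point x of
  -- the lines ab and cd, computed from ab on the left and from cd on the right.
  intersection-identity : ∀ a b c d →
    (orient c d a - orient c d b ≡ - (orient a b c - orient a b d)) ×
    (orient c d a * proj₁ b - orient c d b * proj₁ a ≡ - (orient a b c * proj₁ d - orient a b d * proj₁ c)) ×
    (orient c d a * proj₂ b - orient c d b * proj₂ a ≡ - (orient a b c * proj₂ d - orient a b d * proj₂ c))
  intersection-identity (a₁ , a₂) (b₁ , b₂) (c₁ , c₂) (d₁ , d₂) =
    solve 8 (λ a₁ a₂ b₁ b₂ c₁ c₂ d₁ d₂ → let a = (a₁ , a₂) ; b = (b₁ , b₂) ; c = (c₁ , c₂) ; d = (d₁ , d₂) in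
      orientᴾ c d a :- orientᴾ c d b := :- (orientᴾ a b c :- orientᴾ a b d)) refl a₁ a₂ b₁ b₂ c₁ c₂ d₁ d₂ ,
    solve 8 (λ a₁ a₂ b₁ b₂ c₁ c₂ d₁ d₂ → let a = (a₁ , a₂) ; b = (b₁ , b₂) ; c = (c₁ , c₂) ; d = (d₁ , d₂) in
      orientᴾ c d a :* b₁ :- orientᴾ c d b :* a₁ := :- (orientᴾ a b c :* d₁ :- orientᴾ a b d :* c₁))
      refl a₁ a₂ b₁ b₂ c₁ c₂ d₁ d₂ ,
    solve 8 (λ a₁ a₂ b₁ b₂ c₁ c₂ d₁ d₂ → let a = (a₁ , a₂) ; b = (b₁ , b₂) ; c = (c₁ , c₂) ; d = (d₁ , d₂) in
      orientᴾ c d a :* b₂ :- orientᴾ c d b :* a₂ := :- (orientᴾ a b c :* d₂ :- orientᴾ a b d :* c₂))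
      refl a₁ a₂ b₁ b₂ c₁ c₂ d₁ d₂

  scaled-interpolation : ∀ t u v a b → t * (u - v) ≡ u → (u - v) * (a + t * (b - a)) ≡ u * b - v * a
  scaled-interpolation t u v a b t[u-v]≡u = begin
    (u - v) * (a + t * (b - a))          ≡⟨ solve 5 (λ t u v a b → (u :- v) :* (a :+ t :* (b :- a))
                                               := (u :- v) :* a :+ (t :* (u :- v)) :* (b :- a)) refl t u v a b ⟩
    (u - v) * a + (t * (u - v)) * (b - a) ≡⟨ cong (λ w → (u - v) * a + w * (b - a)) t[u-v]≡u ⟩
    (u - v) * a + u * (b - a)            ≡⟨ solve 4 (λ u v a b →
                                               (u :- v) :* a :+ u :* (b :- a) := u :* b :- v :* a) refl u v a b ⟩
    u * b - v * a                        ∎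
    where open ≡-Reasoning

  opposite-sides⇒crossing : ∀ a b c d → orient a b c * orient a b d < 0ℚ → orient c d a * orient c d b < 0ℚ →
    Σ[ x ∈ Point ] OnSegment a b x × OnSegment c d x
  opposite-sides⇒crossing a@(a₁ , a₂) b@(b₁ , b₂) c@(c₁ , c₂) d@(d₁ , d₂) abc*abd<0 cda*cdb<0 =
    meet (interpolation-root cda*cdb<0) (interpolation-root abc*abd<0)
    where
    cda = orient c d a
    cdb = orient c d b
    abc = orient a b c
    abd = orient a b d
    identities = intersection-identity a b c d
    meet : Σ[ t ∈ ℚ ] t * (cda - cdb) ≡ cda × 0ℚ ≤ t × t ≤ 1ℚ →
           Σ[ s ∈ ℚ ] s * (abc - abd) ≡ abc × 0ℚ ≤ s × s ≤ 1ℚ →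
           Σ[ x ∈ Point ] OnSegment a b x × OnSegment c d x
    meet (t , tD≡cda , 0≤t , t≤1) (s , sD′≡abc , 0≤s , s≤1) =
      (a₁ + t * (b₁ - a₁) , a₂ + t * (b₂ - a₂)) , (t , 0≤t , t≤1 , refl , refl) ,
      (s , 0≤s , s≤1 , same-coordinate a₁ b₁ c₁ d₁ (proj₁ (proj₂ identities))
                     , same-coordinate a₂ b₂ c₂ d₂ (proj₂ (proj₂ identities)))
      where
      D≢0 : cda - cdb ≢ 0ℚ
      D≢0 D≡0 = <-irrefl (trans (cong (_* cdb) cda≡0) (*-zeroˡ cdb)) cda*cdb<0
        where
        cda≡0 : cda ≡ 0ℚ
        cda≡0 = trans (sym tD≡cda) (trans (cong (t *_) D≡0) (*-zeroʳ t))
      same-coordinate : ∀ aᵢ bᵢ cᵢ dᵢ → cda * bᵢ - cdb * aᵢ ≡ - (abc * dᵢ - abd * cᵢ) →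
        aᵢ + t * (bᵢ - aᵢ) ≡ cᵢ + s * (dᵢ - cᵢ)
      same-coordinate aᵢ bᵢ cᵢ dᵢ identity = *-cancelˡ-≡ D≢0 (begin
        (cda - cdb) * (aᵢ + t * (bᵢ - aᵢ))      ≡⟨ scaled-interpolation t cda cdb aᵢ bᵢ tD≡cda ⟩
        cda * bᵢ - cdb * aᵢ                     ≡⟨ identity ⟩
        - (abc * dᵢ - abd * cᵢ)                 ≡⟨ cong -_ (sym (scaled-interpolation s abc abd cᵢ dᵢ sD′≡abc)) ⟩
        - ((abc - abd) * (cᵢ + s * (dᵢ - cᵢ)))  ≡⟨ neg-distribˡ-* (abc - abd) (cᵢ + s * (dᵢ - cᵢ)) ⟩
        - (abc - abd) * (cᵢ + s * (dᵢ - cᵢ))    ≡⟨ cong (_* (cᵢ + s * (dᵢ - cᵢ))) (sym (proj₁ identities)) ⟩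
        (cda - cdb) * (cᵢ + s * (dᵢ - cᵢ))      ∎)
        where open ≡-Reasoning

  disjoint⇒separated : ∀ a b c d → orient a b c ≢ 0ℚ → orient a b d ≢ 0ℚ → orient c d a ≢ 0ℚ → orient c d b ≢ 0ℚ →
    (∀ x → OnSegment a b x → OnSegment c d x → ⊥) → Separated a b c d
  disjoint⇒separated a b c d abc≢0 abd≢0 cda≢0 cdb≢0 disjoint
    with <-cmp (orient a b c * orient a b d) 0ℚ | <-cmp (orient c d a * orient c d b) 0ℚ
  ... | tri≈ _ abc*abd≡0 _ | _ = ⊥-elim (≢0*≢0⇒≢0 abc≢0 abd≢0 abc*abd≡0)
  ... | _ | tri≈ _ cda*cdb≡0 _ = ⊥-elim (≢0*≢0⇒≢0 cda≢0 cdb≢0 cda*cdb≡0)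
  ... | tri> _ _ 0<abc*abd | _ = inj₁ (sameSide (orient a b c) (p≢0⇒0<p*p abc≢0) 0<abc*abd)
  ... | _ | tri> _ _ 0<cda*cdb = inj₂ (sameSide (orient c d a) (p≢0⇒0<p*p cda≢0) 0<cda*cdb)
  ... | tri< abc*abd<0 _ _ | tri< cda*cdb<0 _ _ =
    let (x , x∈ab , x∈cd) = opposite-sides⇒crossing a b c d abc*abd<0 cda*cdb<0 in ⊥-elim (disjoint x x∈ab x∈cd)

open Orientation

module Perturbation where

  open import Data.Rational
  open import Data.Rational.Properties
  open import Algebra.Properties.Group +-0-group using (x≈y⇒x∙y⁻¹≈ε; ∙-cancelˡ)
  open +-*-Solver

  -- The copies of a point A lie on the parabola A + (ε²r, εr²): they tend to A as ε → 0, and no three of them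
  -- are collinear.
  perturb : ℚ → Point → ℚ → Point
  perturb ε (x , y) r = (x + ε * ε * r , y + ε * (r * r))

  perturbᴾ : ∀ {n} → Polynomial n → Polynomial n × Polynomial n → Polynomial n → Polynomial n × Polynomial n
  perturbᴾ ε (x , y) r = (x :+ ε :* ε :* r , y :+ ε :* (r :* r))

  orientCoefficients : Point → Point → Point → ℚ → ℚ → ℚ → List ℚ
  orientCoefficients (a₁ , a₂) (b₁ , b₂) (c₁ , c₂) ra rb rc =
    orient (a₁ , a₂) (b₁ , b₂) (c₁ , c₂) ∷
    (b₁ - a₁) * (rc * rc - ra * ra) - (rb * rb - ra * ra) * (c₁ - a₁) ∷
    (rb - ra) * (c₂ - a₂) - (b₂ - a₂) * (rc - ra) ∷
    (rb - ra) * (rc * rc - ra * ra) - (rb * rb - ra * ra) * (rc - ra) ∷ []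

  orient-perturb : ∀ ε a b c ra rb rc →
    orient (perturb ε a ra) (perturb ε b rb) (perturb ε c rc) ≡ eval (orientCoefficients a b c ra rb rc) ε
  orient-perturb ε (a₁ , a₂) (b₁ , b₂) (c₁ , c₂) ra rb rc = solve 10
    (λ ε a₁ a₂ b₁ b₂ c₁ c₂ ra rb rc →
      orientᴾ (perturbᴾ ε (a₁ , a₂) ra) (perturbᴾ ε (b₁ , b₂) rb) (perturbᴾ ε (c₁ , c₂) rc)
      := orientᴾ (a₁ , a₂) (b₁ , b₂) (c₁ , c₂)
         :+ ε :* (((b₁ :- a₁) :* (rc :* rc :- ra :* ra) :- (rb :* rb :- ra :* ra) :* (c₁ :- a₁))
         :+ ε :* (((rb :- ra) :* (c₂ :- a₂) :- (b₂ :- a₂) :* (rc :- ra))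
         :+ ε :* (((rb :- ra) :* (rc :* rc :- ra :* ra) :- (rb :* rb :- ra :* ra) :* (rc :- ra))
         :+ ε :* con 0ℚ))))
    refl ε a₁ a₂ b₁ b₂ c₁ c₂ ra rb rc

  orientCoefficients-twice : Point → Point → ℚ → ℚ → ℚ → List ℚ
  orientCoefficients-twice (a₁ , a₂) (c₁ , c₂) ra rb rc =
    0ℚ ∷ (ra * ra - rb * rb) * (c₁ - a₁) ∷ (rb - ra) * (c₂ - a₂) ∷ (rb - ra) * (rc - ra) * (rc - rb) ∷ []

  orient-perturb-twice : ∀ ε a c ra rb rc →
    orient (perturb ε a ra) (perturb ε a rb) (perturb ε c rc) ≡ eval (orientCoefficients-twice a c ra rb rc) ε
  orient-perturb-twice ε (a₁ , a₂) (c₁ , c₂) ra rb rc = solve 8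
    (λ ε a₁ a₂ c₁ c₂ ra rb rc →
      orientᴾ (perturbᴾ ε (a₁ , a₂) ra) (perturbᴾ ε (a₁ , a₂) rb) (perturbᴾ ε (c₁ , c₂) rc)
      := con 0ℚ
         :+ ε :* ((ra :* ra :- rb :* rb) :* (c₁ :- a₁)
         :+ ε :* ((rb :- ra) :* (c₂ :- a₂)
         :+ ε :* ((rb :- ra) :* (rc :- ra) :* (rc :- rb)
         :+ ε :* con 0ℚ))))
    refl ε a₁ a₂ c₁ c₂ ra rb rc

  eventually-sameSide-perturb : ∀ {a b c d} ra rb rc rd → SameSide a b c d →
    Eventually (λ ε → SameSide (perturb ε a ra) (perturb ε b rb) (perturb ε c rc) (perturb ε d rd))
  eventually-sameSide-perturb {a} {b} {c} {d} ra rb rc rd (sameSide σ c-side d-side) =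
    eventually-map (λ _ _ (c-side , d-side) → sameSide σ c-side d-side)
      (eventually-× (lift c rc c-side) (lift d rd d-side))
    where
    lift : ∀ x rx → 0ℚ < σ * orient a b x →
      Eventually (λ ε → 0ℚ < σ * orient (perturb ε a ra) (perturb ε b rb) (perturb ε x rx))
    lift x rx x-side = eventually-map (λ ε _ → subst (λ o → 0ℚ < σ * o) (sym (orient-perturb ε a b x ra rb rx)))
      (eventually-0<σ*eval σ (orientCoefficients a b x ra rb rx) (here x-side))

  eventually-separated-perturb : ∀ {a b c d} ra rb rc rd → Separated a b c d →
    Eventually (λ ε → Separated (perturb ε a ra) (perturb ε b rb) (perturb ε c rc) (perturb ε d rd))
  eventually-separated-perturb ra rb rc rd (inj₁ abcd) =
    eventually-map (λ _ _ → inj₁) (eventually-sameSide-perturb ra rb rc rd abcd)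
  eventually-separated-perturb ra rb rc rd (inj₂ cdab) =
    eventually-map (λ _ _ → inj₂) (eventually-sameSide-perturb rc rd ra rb cdab)

  ≢⇒coordinate-≢ : ∀ {a₁ a₂ c₁ c₂} → (a₁ , a₂) ≢ (c₁ , c₂) → c₁ - a₁ ≢ 0ℚ ⊎ (c₁ - a₁ ≡ 0ℚ × c₂ - a₂ ≢ 0ℚ)
  ≢⇒coordinate-≢ {a₁} {a₂} {c₁} {c₂} a≢c with c₁ - a₁ ≟ 0ℚ
  ... | no  c₁-a₁≢0 = inj₁ c₁-a₁≢0
  ... | yes c₁-a₁≡0 = inj₂ (c₁-a₁≡0 , λ c₂-a₂≡0 → a≢c (sym (cong₂ _,_ (p-q≡0⇒p≡q c₁-a₁≡0) (p-q≡0⇒p≡q c₂-a₂≡0))))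

  eventually-orient≢0-perturb : ∀ a b c ra rb rc → orient a b c ≢ 0ℚ →
    Eventually (λ ε → orient (perturb ε a ra) (perturb ε b rb) (perturb ε c rc) ≢ 0ℚ)
  eventually-orient≢0-perturb a b c ra rb rc abc≢0 =
    eventually-map (λ ε _ ≢0 ≡0 → ≢0 (trans (sym (orient-perturb ε a b c ra rb rc)) ≡0))
      (eventually-eval≢0 (orientCoefficients a b c ra rb rc) (here abc≢0))

  eventually-orient≢0-perturb-twice : ∀ a c ra rb rc → a ≢ c → rb - ra ≢ 0ℚ → ra * ra - rb * rb ≢ 0ℚ →
    Eventually (λ ε → orient (perturb ε a ra) (perturb ε a rb) (perturb ε c rc) ≢ 0ℚ)
  eventually-orient≢0-perturb-twice a@(a₁ , a₂) c@(c₁ , c₂) ra rb rc a≢c rb-ra≢0 ra²-rb²≢0 =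
    eventually-map (λ ε _ ≢0 ≡0 → ≢0 (trans (sym (orient-perturb-twice ε a c ra rb rc)) ≡0))
      (eventually-eval≢0 (orientCoefficients-twice a c ra rb rc) (leading (≢⇒coordinate-≢ a≢c)))
    where
    leading : c₁ - a₁ ≢ 0ℚ ⊎ (c₁ - a₁ ≡ 0ℚ × c₂ - a₂ ≢ 0ℚ) →
      Leading (_≢ 0ℚ) (orientCoefficients-twice a c ra rb rc)
    leading (inj₁ c₁-a₁≢0) = skip refl (here (≢0*≢0⇒≢0 ra²-rb²≢0 c₁-a₁≢0))
    leading (inj₂ (c₁-a₁≡0 , c₂-a₂≢0)) = skip refl (skip
      (trans (cong ((ra * ra - rb * rb) *_) c₁-a₁≡0) (*-zeroʳ (ra * ra - rb * rb)))
      (here (≢0*≢0⇒≢0 rb-ra≢0 c₂-a₂≢0)))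

  eventually-orient≢0-perturb-thrice : ∀ a ra rb rc → rb - ra ≢ 0ℚ → rc - ra ≢ 0ℚ → rc - rb ≢ 0ℚ →
    Eventually (λ ε → orient (perturb ε a ra) (perturb ε a rb) (perturb ε a rc) ≢ 0ℚ)
  eventually-orient≢0-perturb-thrice a@(a₁ , a₂) ra rb rc rb-ra≢0 rc-ra≢0 rc-rb≢0 =
    eventually-map (λ ε _ ≢0 ≡0 → ≢0 (trans (sym (orient-perturb-twice ε a a ra rb rc)) ≡0))
      (eventually-eval≢0 (orientCoefficients-twice a a ra rb rc)
        (skip refl (skip (vanishes (ra * ra - rb * rb) a₁) (skip (vanishes (rb - ra) a₂)
        (here (≢0*≢0⇒≢0 (≢0*≢0⇒≢0 rb-ra≢0 rc-ra≢0) rc-rb≢0))))))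
    where
    vanishes : ∀ p x → p * (x - x) ≡ 0ℚ
    vanishes p x = trans (cong (p *_) (+-inverseʳ x)) (*-zeroʳ p)

  -- Two copies of a span an almost vertical line: c lies on the side given by the sign of c₁ − a₁, or, when
  -- c₁ = a₁, by the slight tilt of that line.
  eventually-sameSide-cluster : ∀ a c ra rt → a ≢ c → 0ℚ < rt - ra → 0ℚ < rt * rt - ra * ra → ∀ rc rd →
    Eventually (λ ε → SameSide (perturb ε a rt) (perturb ε a ra) (perturb ε c rc) (perturb ε c rd))
  eventually-sameSide-cluster a@(a₁ , a₂) c@(c₁ , c₂) ra rt a≢c 0<rt-ra 0<rt²-ra² rc rd =
    eventually-map (λ _ _ (c-side , d-side) → sameSide σ c-side d-side) (eventually-× (side rc) (side rd))
    where
    coefficients : ℚ → List ℚ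
    coefficients = orientCoefficients-twice a c rt ra
    sign : c₁ - a₁ ≢ 0ℚ ⊎ (c₁ - a₁ ≡ 0ℚ × c₂ - a₂ ≢ 0ℚ) →
      Σ[ σ ∈ ℚ ] ∀ rx → Leading (0ℚ <_) (map (σ *_) (coefficients rx))
    sign (inj₁ c₁-a₁≢0) = c₁ - a₁ , λ rx → skip (*-zeroʳ (c₁ - a₁)) (here (subst (0ℚ <_)
      (solve 3 (λ u ra rt → (rt :* rt :- ra :* ra) :* (u :* u) := u :* ((rt :* rt :- ra :* ra) :* u))
        refl (c₁ - a₁) ra rt)
      (pos*pos⇒0< 0<rt²-ra² (p≢0⇒0<p*p c₁-a₁≢0))))
    sign (inj₂ (c₁-a₁≡0 , c₂-a₂≢0)) = - (c₂ - a₂) , λ rx → skip (*-zeroʳ (- (c₂ - a₂))) (skip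
      (trans (cong (λ u → - (c₂ - a₂) * ((rt * rt - ra * ra) * u)) c₁-a₁≡0)
        (solve 3 (λ v ra rt → :- v :* ((rt :* rt :- ra :* ra) :* con 0ℚ) := con 0ℚ) refl (c₂ - a₂) ra rt))
      (here (subst (0ℚ <_)
        (solve 3 (λ v ra rt → (rt :- ra) :* (v :* v) := :- v :* ((ra :- rt) :* v)) refl (c₂ - a₂) ra rt)
        (pos*pos⇒0< 0<rt-ra (p≢0⇒0<p*p c₂-a₂≢0)))))
    σ = proj₁ (sign (≢⇒coordinate-≢ a≢c))
    side : ∀ rx → Eventually (λ ε → 0ℚ < σ * orient (perturb ε a rt) (perturb ε a ra) (perturb ε c rx))
    side rx = eventually-map (λ ε _ → subst (λ o → 0ℚ < σ * o) (sym (orient-perturb-twice ε a c rt ra rx)))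
      (eventually-0<σ*eval σ (coefficients rx) (proj₂ (sign (≢⇒coordinate-≢ a≢c)) rx))

  perturb-injectiveʳ : ∀ {ε} a ra rb → 0ℚ < ε → ra * ra ≢ rb * rb → perturb ε a ra ≢ perturb ε a rb
  perturb-injectiveʳ {ε} (a₁ , a₂) ra rb 0<ε ra²≢rb² same =
    ra²≢rb² (*-cancelˡ-≡ (0<p⇒p≢0 0<ε) (∙-cancelˡ a₂ (ε * (ra * ra)) (ε * (rb * rb)) (cong proj₂ same)))

  eventually-perturb-≢ : ∀ a b ra rb → a ≢ b → Eventually (λ ε → perturb ε a ra ≢ perturb ε b rb)
  eventually-perturb-≢ a@(a₁ , a₂) b@(b₁ , b₂) ra rb a≢b with ≢⇒coordinate-≢ (λ b≡a → a≢b (sym b≡a))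
  ... | inj₁ a₁-b₁≢0 = eventually-map
    (λ ε _ ≢0 same → ≢0 (trans
      (solve 5 (λ ε a₁ b₁ ra rb → a₁ :- b₁ :+ ε :* (con 0ℚ :+ ε :* (ra :- rb :+ ε :* con 0ℚ))
                                   := (a₁ :+ ε :* ε :* ra) :- (b₁ :+ ε :* ε :* rb)) refl ε a₁ b₁ ra rb)
      (x≈y⇒x∙y⁻¹≈ε (cong proj₁ same))))
    (eventually-eval≢0 (a₁ - b₁ ∷ 0ℚ ∷ ra - rb ∷ []) (here a₁-b₁≢0))
  ... | inj₂ (_ , a₂-b₂≢0) = eventually-map
    (λ ε _ ≢0 same → ≢0 (trans
      (solve 5 (λ ε a₂ b₂ ra rb → a₂ :- b₂ :+ ε :* (ra :* ra :- rb :* rb :+ ε :* con 0ℚ)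
                                   := (a₂ :+ ε :* (ra :* ra)) :- (b₂ :+ ε :* (rb :* rb))) refl ε a₂ b₂ ra rb)
      (x≈y⇒x∙y⁻¹≈ε (cong proj₂ same))))
    (eventually-eval≢0 (a₂ - b₂ ∷ ra * ra - rb * rb ∷ []) (here a₂-b₂≢0))

  fromℕ : ℕ → ℚ
  fromℕ zero    = 0ℚ
  fromℕ (suc n) = 1ℚ + fromℕ n

  fromℕ-<-suc : ∀ n → fromℕ n < fromℕ (suc n)
  fromℕ-<-suc n = subst (_< 1ℚ + fromℕ n) (+-identityˡ (fromℕ n)) (+-monoˡ-< (fromℕ n) (positive⁻¹ 1ℚ))

  fromℕ-nonNeg : ∀ n → 0ℚ ≤ fromℕ n
  fromℕ-nonNeg zero    = ≤-refl
  fromℕ-nonNeg (suc n) = <⇒≤ (≤-<-trans (fromℕ-nonNeg n) (fromℕ-<-suc n))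

  fromℕ-mono-< : ∀ {m n} → m ℕ.< n → fromℕ m < fromℕ n
  fromℕ-mono-< {m} {suc n} (ℕ.s≤s m≤n) with ℕₚ.m≤n⇒m<n∨m≡n m≤n
  ... | inj₁ m<n  = <-trans (fromℕ-mono-< m<n) (fromℕ-<-suc n)
  ... | inj₂ refl = fromℕ-<-suc n

  square-mono-< : ∀ {p q} → 0ℚ ≤ p → p < q → p * p < q * q
  square-mono-< {p} {q} 0≤p p<q = ≤-<-trans
    (*-monoˡ-≤-nonNeg p {{nonNegative 0≤p}} (<⇒≤ p<q))
    (*-monoˡ-<-pos q {{positive (≤-<-trans 0≤p p<q)}} p<q)

  module _ {k : ℕ} where

    radius : Fin k → ℚ
    radius t = fromℕ (toℕ t)

    radius-< : ∀ {t u} → t Fin.< u → radius t < radius u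
    radius-< = fromℕ-mono-<

    radius²-< : ∀ {t u} → t Fin.< u → radius t * radius t < radius u * radius u
    radius²-< {t} t<u = square-mono-< (fromℕ-nonNeg (toℕ t)) (radius-< t<u)

    mono-<⇒injective : ∀ {f : Fin k → ℚ} → (∀ {t u} → t Fin.< u → f t < f u) → ∀ {t u} → t ≢ u → f t ≢ f u
    mono-<⇒injective {f} mono {t} {u} t≢u with Finₚ.<-cmp t u
    ... | tri< t<u _ _ = <⇒≢ (mono t<u)
    ... | tri≈ _ t≡u _ = ⊥-elim (t≢u t≡u)
    ... | tri> _ _ u<t = ≢-sym (<⇒≢ (mono u<t))

open Perturbation

-- The notions of Defs over an arbitrary vertex type; at Fin n they unfold to the originals.
module _ {V : Set} where

  GeneralPosition′ : (V → Point) → Set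
  GeneralPosition′ P =
    (∀ i j → i ≢ j → P i ≢ P j) ×
    (∀ i j k → i ≢ j → j ≢ k → i ≢ k → ¬ Collinear (P i) (P j) (P k))

  IsStarForestWith′ : (V → V → Set) → (V → V) → Set
  IsStarForestWith′ E cen =
    (∀ v → cen (cen v) ≡ cen v) ×
    (∀ i j → (E i j → (i ≢ j × (cen i ≡ j ⊎ cen j ≡ i))) ×
             ((i ≢ j × (cen i ≡ j ⊎ cen j ≡ i)) → E i j))

  DistinctEdges′ : V → V → V → V → Set
  DistinctEdges′ a b c d = ¬ ((a ≡ c × b ≡ d) ⊎ (a ≡ d × b ≡ c))

  Plane′ : (V → Point) → (V → V → Set) → Set
  Plane′ P E = ∀ a b c d → E a b → E c d → DistinctEdges′ a b c d →
    MeetAtMostInCommonEndpoint (P a) (P b) (P c) (P d)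

module _ {V W : Set} where

  ColourClass′ : (V → V → W) → W → V → V → Set
  ColourClass′ col f i j = (i ≢ j) × (col i j ≡ f)

  StarForestPartition′ : (V → Point) → (V → V → W) → (W → V → V) → Set
  StarForestPartition′ P col cen =
    (∀ i j → col i j ≡ col j i) ×
    (∀ f → IsStarForestWith′ (ColourClass′ col f) (cen f) × Plane′ P (ColourClass′ col f))

meetAtMost-swapˡ : ∀ a b c d → MeetAtMostInCommonEndpoint a b c d → MeetAtMostInCommonEndpoint b a c d
meetAtMost-swapˡ a b c d meet x x∈ba x∈cd = swap (proj₁ r) , proj₂ r
  where r = meet x (onSegment-sym b a x x∈ba) x∈cd

meetAtMost-swapʳ : ∀ a b c d → MeetAtMostInCommonEndpoint a b c d → MeetAtMostInCommonEndpoint a b d c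
meetAtMost-swapʳ a b c d meet x x∈ab x∈dc = proj₁ r , swap (proj₂ r)
  where r = meet x x∈ab (onSegment-sym d c x x∈dc)

meetAtMost⇒disjoint : ∀ {a b c d} → a ≢ c → a ≢ d → b ≢ c → b ≢ d → MeetAtMostInCommonEndpoint a b c d →
  ∀ x → OnSegment a b x → OnSegment c d x → ⊥
meetAtMost⇒disjoint a≢c a≢d b≢c b≢d meet x x∈ab x∈cd with meet x x∈ab x∈cd
... | inj₁ x≡a , inj₁ x≡c = a≢c (trans (sym x≡a) x≡c)
... | inj₁ x≡a , inj₂ x≡d = a≢d (trans (sym x≡a) x≡d)
... | inj₂ x≡b , inj₁ x≡c = b≢c (trans (sym x≡b) x≡c)
... | inj₂ x≡b , inj₂ x≡d = b≢d (trans (sym x≡b) x≡d)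

module _ {V : Set} (cen : V → V) where

  StarEdge : V → V → Set
  StarEdge i j = i ≢ j × (cen i ≡ j ⊎ cen j ≡ i)

  data LeafEdge : V → V → Set where
    leaf→centre : ∀ {l} → l ≢ cen l → LeafEdge l (cen l)
    centre→leaf : ∀ {l} → l ≢ cen l → LeafEdge (cen l) l

  starEdge⇒leafEdge : ∀ {i j} → StarEdge i j → LeafEdge i j
  starEdge⇒leafEdge (i≢j , inj₁ refl) = leaf→centre i≢j
  starEdge⇒leafEdge (i≢j , inj₂ refl) = centre→leaf (λ j≡i → i≢j (sym j≡i))

module _ {V : Set} (P : V → Point) (cen : V → V) where

  LeafEdgesSeparated : Set
  LeafEdgesSeparated = ∀ l₁ l₂ → l₁ ≢ cen l₁ → l₂ ≢ cen l₂ → cen l₁ ≢ cen l₂ →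
    Separated (P l₁) (P (cen l₁)) (P l₂) (P (cen l₂))

plane-⊆ : ∀ {V : Set} {P : V → Point} {E F : V → V → Set} → (∀ {i j} → E i j → F i j) → Plane′ P F → Plane′ P E
plane-⊆ E⊆F plane a b c d ab cd = plane a b c d (E⊆F ab) (E⊆F cd)

module _ {V : Set} {P : V → Point} (gp : GeneralPosition′ P) where

  orient≢0 : ∀ {i j k} → i ≢ j → j ≢ k → i ≢ k → orient (P i) (P j) (P k) ≢ 0ℚ
  orient≢0 {i} {j} {k} i≢j j≢k i≢k ijk≡0 =
    proj₂ gp i j k i≢j j≢k i≢k (orient≡0⇒collinear (P i) (P j) (P k) (proj₁ gp i j i≢j) ijk≡0)

  plane-of-leafEdgesSeparated : DecidableEquality V → {cen : V → V} → LeafEdgesSeparated P cen →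
    Plane′ P (StarEdge cen)
  plane-of-leafEdgesSeparated _≟_ {cen} separated a b c d ab cd distinct =
    meet (starEdge⇒leafEdge cen ab) (starEdge⇒leafEdge cen cd) distinct
    where
    leaves-meet : ∀ l₁ l₂ → l₁ ≢ cen l₁ → l₂ ≢ cen l₂ → l₁ ≢ l₂ →
      MeetAtMostInCommonEndpoint (P l₁) (P (cen l₁)) (P l₂) (P (cen l₂))
    leaves-meet l₁ l₂ leaf₁ leaf₂ l₁≢l₂ x x∈₁ x∈₂ with cen l₁ ≟ cen l₂
    ... | no c₁≢c₂ = separated⇒meetAtMostInCommonEndpoint (separated l₁ l₂ leaf₁ leaf₂ c₁≢c₂) x x∈₁ x∈₂
    ... | yes c₁≡c₂ = inj₂ x≡c , inj₂ (trans x≡c (cong P c₁≡c₂))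
      where
      c≢l₂ : cen l₁ ≢ l₂
      c≢l₂ c≡l₂ = leaf₂ (trans (sym c≡l₂) c₁≡c₂)
      x≡c : x ≡ P (cen l₁)
      x≡c = onSegments-from-common-point (P (cen l₁)) (P l₁) (P l₂) x
        (orient≢0 (λ c≡l₁ → leaf₁ (sym c≡l₁)) l₁≢l₂ c≢l₂)
        (onSegment-sym (P l₁) (P (cen l₁)) x x∈₁)
        (subst (λ c → OnSegment (P c) (P l₂) x) (sym c₁≡c₂) (onSegment-sym (P l₂) (P (cen l₂)) x x∈₂))
    meet : ∀ {a b c d} → LeafEdge cen a b → LeafEdge cen c d → DistinctEdges′ a b c d →
      MeetAtMostInCommonEndpoint (P a) (P b) (P c) (P d)
    meet (leaf→centre {l₁} leaf₁) (leaf→centre {l₂} leaf₂) distinct =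
      leaves-meet l₁ l₂ leaf₁ leaf₂ (λ l₁≡l₂ → distinct (inj₁ (l₁≡l₂ , cong cen l₁≡l₂)))
    meet (leaf→centre {l₁} leaf₁) (centre→leaf {l₂} leaf₂) distinct = meetAtMost-swapʳ _ _ _ _
      (leaves-meet l₁ l₂ leaf₁ leaf₂ (λ l₁≡l₂ → distinct (inj₂ (l₁≡l₂ , cong cen l₁≡l₂))))
    meet (centre→leaf {l₁} leaf₁) (leaf→centre {l₂} leaf₂) distinct = meetAtMost-swapˡ _ _ _ _
      (leaves-meet l₁ l₂ leaf₁ leaf₂ (λ l₁≡l₂ → distinct (inj₂ (cong cen l₁≡l₂ , l₁≡l₂))))
    meet (centre→leaf {l₁} leaf₁) (centre→leaf {l₂} leaf₂) distinct =
      meetAtMost-swapˡ _ _ _ _ (meetAtMost-swapʳ _ _ _ _ (leaves-meet l₁ l₂ leaf₁ leaf₂ (λ l₁≡l₂ → distinct (inj₁ (cong cen l₁≡l₂ , l₁≡l₂)))))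

  leafEdgesSeparated-of-plane : ∀ {E cen} → IsStarForestWith′ E cen → Plane′ P E → LeafEdgesSeparated P cen
  leafEdgesSeparated-of-plane {E} {cen} (idem , star) plane l₁ l₂ leaf₁ leaf₂ c₁≢c₂ =
    disjoint⇒separated (P l₁) (P c₁) (P l₂) (P c₂)
      (orient≢0 leaf₁ c₁≢l₂ l₁≢l₂) (orient≢0 leaf₁ c₁≢c₂ l₁≢c₂)
      (orient≢0 leaf₂ (≢-sym l₁≢c₂) (≢-sym l₁≢l₂)) (orient≢0 leaf₂ (≢-sym c₁≢c₂) (≢-sym c₁≢l₂))
      (meetAtMost⇒disjoint (P≢ l₁≢l₂) (P≢ l₁≢c₂) (P≢ c₁≢l₂) (P≢ c₁≢c₂)
        (plane l₁ c₁ l₂ c₂ (edge leaf₁) (edge leaf₂) distinct))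
    where
    c₁ = cen l₁
    c₂ = cen l₂
    P≢ : ∀ {i j} → i ≢ j → P i ≢ P j
    P≢ = proj₁ gp _ _
    l₁≢l₂ : l₁ ≢ l₂
    l₁≢l₂ l₁≡l₂ = c₁≢c₂ (cong cen l₁≡l₂)
    l₁≢c₂ : l₁ ≢ c₂
    l₁≢c₂ l₁≡c₂ = leaf₁ (trans l₁≡c₂ (trans (sym (idem l₂)) (cong cen (sym l₁≡c₂))))
    c₁≢l₂ : c₁ ≢ l₂
    c₁≢l₂ c₁≡l₂ = leaf₂ (trans (sym c₁≡l₂) (trans (sym (idem l₁)) (cong cen c₁≡l₂)))
    edge : ∀ {l} → l ≢ cen l → E l (cen l)
    edge {l} leaf = proj₂ (star l (cen l)) (leaf , inj₁ refl)
    distinct : DistinctEdges′ l₁ c₁ l₂ c₂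
    distinct (inj₁ (l₁≡l₂ , _)) = l₁≢l₂ l₁≡l₂
    distinct (inj₂ (l₁≡c₂ , _)) = l₁≢c₂ l₁≡c₂

module _ {A V : Set} (e : A ↔ V) where

  private
    module e = Inverse e

  to-injective : ∀ {x y} → e.to x ≡ e.to y → x ≡ y
  to-injective = Injection.injective (↔⇒↣ e)

  to-≢ : ∀ {x y} → x ≢ y → e.to x ≢ e.to y
  to-≢ x≢y eq = x≢y (to-injective eq)

  relabel-generalPosition : ∀ {P : V → Point} → GeneralPosition′ P → GeneralPosition′ (P ∘ e.to)
  relabel-generalPosition (injective , nonCollinear) =
    (λ i j i≢j → injective (e.to i) (e.to j) (to-≢ i≢j)) ,
    (λ i j k i≢j j≢k i≢k → nonCollinear (e.to i) (e.to j) (e.to k) (to-≢ i≢j) (to-≢ j≢k) (to-≢ i≢k))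

module _ {A V B W : Set} (e : A ↔ V) (eᶜ : B ↔ W) where

  private
    module e = Inverse e
    module eᶜ = Inverse eᶜ

    from≡⇒≡to : ∀ {v x} → e.from v ≡ x → v ≡ e.to x
    from≡⇒≡to {v} refl = sym (e.strictlyInverseˡ v)

    ≡to⇒from≡ : ∀ {v x} → v ≡ e.to x → e.from v ≡ x
    ≡to⇒from≡ {x = x} refl = e.strictlyInverseʳ x

  relabel-starForestPartition : ∀ {P : V → Point} {col : V → V → W} {cen : W → V → V} →
    StarForestPartition′ P col cen →
    StarForestPartition′ (P ∘ e.to) (λ x y → eᶜ.from (col (e.to x) (e.to y)))
                                    (λ f x → e.from (cen (eᶜ.to f) (e.to x)))
  relabel-starForestPartition {P} {col} {cen} (col-sym , forests) =
    (λ x y → cong eᶜ.from (col-sym (e.to x) (e.to y))) , λ f → (idem f , star f) , plane f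
    where
    col′ : A → A → B
    col′ x y = eᶜ.from (col (e.to x) (e.to y))
    cen′ : B → A → A
    cen′ f x = e.from (cen (eᶜ.to f) (e.to x))
    colourClass⇒ : ∀ {f x y} → ColourClass′ col′ f x y → ColourClass′ col (eᶜ.to f) (e.to x) (e.to y)
    colourClass⇒ (x≢y , col′≡f) = to-≢ e x≢y , trans (sym (eᶜ.strictlyInverseˡ _)) (cong eᶜ.to col′≡f)
    colourClass⇐ : ∀ {f x y} → ColourClass′ col (eᶜ.to f) (e.to x) (e.to y) → ColourClass′ col′ f x y
    colourClass⇐ {f} (to≢ , col≡) =
      (λ x≡y → to≢ (cong e.to x≡y)) , trans (cong eᶜ.from col≡) (eᶜ.strictlyInverseʳ f)
    idem : ∀ f v → cen′ f (cen′ f v) ≡ cen′ f v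
    idem f v = cong e.from
      (trans (cong (cen (eᶜ.to f)) (e.strictlyInverseˡ _)) (proj₁ (proj₁ (forests (eᶜ.to f))) (e.to v)))
    star : ∀ f x y → (ColourClass′ col′ f x y → x ≢ y × (cen′ f x ≡ y ⊎ cen′ f y ≡ x)) ×
                     (x ≢ y × (cen′ f x ≡ y ⊎ cen′ f y ≡ x) → ColourClass′ col′ f x y)
    star f x y =
      (λ cc → proj₁ cc , Sum.map ≡to⇒from≡ ≡to⇒from≡ (proj₂ (proj₁ star₀ (colourClass⇒ cc)))) ,
      (λ (x≢y , centred) → colourClass⇐ (proj₂ star₀ (to-≢ e x≢y , Sum.map from≡⇒≡to from≡⇒≡to centred)))
      where star₀ = proj₂ (proj₁ (forests (eᶜ.to f))) (e.to x) (e.to y)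
    plane : ∀ f → Plane′ (P ∘ e.to) (ColourClass′ col′ f)
    plane f a b c d ab cd distinct = proj₂ (forests (eᶜ.to f)) (e.to a) (e.to b) (e.to c) (e.to d)
      (colourClass⇒ ab) (colourClass⇒ cd) (distinct ∘ Sum.map (Product.map (to-injective e) (to-injective e))
                                                                (Product.map (to-injective e) (to-injective e)))

module _ {V W : Set} {col : V → V → W} {cen : W → V → V} {f : W} where

  isStarForest-of-centres : (∀ i j → col i j ≡ col j i) → (∀ v → cen f (cen f v) ≡ cen f v) →
    (∀ i j → i ≢ j → col i j ≡ f → cen f i ≡ j ⊎ cen f j ≡ i) →
    (∀ i j → i ≢ j → cen f i ≡ j → col i j ≡ f) →
    IsStarForestWith′ (ColourClass′ col f) (cen f)
  isStarForest-of-centres col-sym idem colour⇒star centre⇒colour = idem , λ i j →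
    (λ (i≢j , colour≡f) → i≢j , colour⇒star i j i≢j colour≡f) ,
    λ { (i≢j , inj₁ cen-i≡j) → i≢j , centre⇒colour i j i≢j cen-i≡j
      ; (i≢j , inj₂ cen-j≡i) → i≢j , trans (col-sym i j) (centre⇒colour j i (≢-sym i≢j) cen-j≡i) }

module BlowUp {V W : Set} (_≟_ : DecidableEquality V) (_≟ᶜ_ : DecidableEquality W) (k : ℕ)
  (col : V → V → W) (cen : W → V → V)
  (col-sym : ∀ i j → col i j ≡ col j i)
  (star : ∀ f → IsStarForestWith′ (ColourClass′ col f) (cen f))
  (home : V → W) (home-centre : ∀ i → cen (home i) i ≡ i) where

  open Min (≤-totalOrder k) using (_⊓_; ⊓-comm; ⊓-assoc; ⊓-idem; ⊓-sel; x⊓y≤y)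

  Vertex = Fin k × V
  Colour = Fin k × W

  -- Colour (a , f) is copy a of the star-forest f.
  centre : Colour → Vertex → Vertex
  centre (a , f) (t , i) with cen f i ≟ i | home i ≟ᶜ f
  ... | no _  | _     = a , cen f i
  ... | yes _ | yes _ = a ⊓ t , i
  ... | yes _ | no _  = t , i

  data CentreView (a : Fin k) (f : W) (t : Fin k) (i : V) : Vertex → Set where
    leaf    : cen f i ≢ i → CentreView a f t i (a , cen f i)
    cluster : cen f i ≡ i → home i ≡ f → CentreView a f t i (a ⊓ t , i)
    own     : cen f i ≡ i → home i ≢ f → CentreView a f t i (t , i)

  centreView : ∀ a f t i → CentreView a f t i (centre (a , f) (t , i))
  centreView a f t i with cen f i ≟ i | home i ≟ᶜ f
  ... | no  ¬c | _     = leaf ¬c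
  ... | yes c  | yes h = cluster c h
  ... | yes c  | no ¬h = own c ¬h

  colour : Vertex → Vertex → Colour
  colour (t , i) (u , j) with i ≟ j
  ... | yes _ = t ⊓ u , home i
  ... | no  _ with cen (col i j) i ≟ j
  ...   | yes _ = u , col i j
  ...   | no  _ = t , col i j

  data ColourView (t : Fin k) (i : V) (u : Fin k) (j : V) : Colour → Set where
    cluster : i ≡ j → ColourView t i u j (t ⊓ u , home i)
    to-j    : i ≢ j → cen (col i j) i ≡ j → ColourView t i u j (u , col i j)
    to-i    : i ≢ j → cen (col i j) j ≡ i → ColourView t i u j (t , col i j)

  colourView : ∀ t i u j → ColourView t i u j (colour (t , i) (u , j))
  colourView t i u j with i ≟ j
  ... | yes i≡j = cluster i≡j
  ... | no  i≢j with cen (col i j) i ≟ j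
  ...   | yes cen-i≡j = to-j i≢j cen-i≡j
  ...   | no  cen-i≢j = to-i i≢j (cen-j≡i (proj₂ (proj₁ (proj₂ (star (col i j)) i j) (i≢j , refl))))
    where
    cen-j≡i : cen (col i j) i ≡ j ⊎ cen (col i j) j ≡ i → cen (col i j) j ≡ i
    cen-j≡i (inj₁ cen-i≡j) = ⊥-elim (cen-i≢j cen-i≡j)
    cen-j≡i (inj₂ cen-j≡i) = cen-j≡i

  cen-idem : ∀ f v → cen f (cen f v) ≡ cen f v
  cen-idem f = proj₁ (star f)

  not-both : ∀ {f i j} → i ≢ j → cen f i ≡ j → cen f j ≡ i → ⊥
  not-both {f} {i} i≢j cen-i≡j cen-j≡i =
    i≢j (trans (sym cen-j≡i) (trans (cong (cen f) (sym cen-i≡j)) (trans (cen-idem f i) cen-i≡j)))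

  ⊓-absorbʳ : ∀ s t → (s ⊓ t) ⊓ t ≡ s ⊓ t
  ⊓-absorbʳ s t = trans (⊓-assoc s t t) (cong (s ⊓_) (⊓-idem t))

  ⊓≢ʳ⇒≡ˡ : ∀ {s t} → s ⊓ t ≢ t → s ⊓ t ≡ s
  ⊓≢ʳ⇒≡ˡ {s} {t} s⊓t≢t with ⊓-sel s t
  ... | inj₁ s⊓t≡s = s⊓t≡s
  ... | inj₂ s⊓t≡t = ⊥-elim (s⊓t≢t s⊓t≡t)

  centre-leaf : ∀ {a f t i} → cen f i ≢ i → centre (a , f) (t , i) ≡ (a , cen f i)
  centre-leaf {a} {f} {t} {i} ¬c with centre (a , f) (t , i) | centreView a f t i
  ... | _ | leaf _      = refl
  ... | _ | cluster c _ = ⊥-elim (¬c c)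
  ... | _ | own c _     = ⊥-elim (¬c c)

  centre-cluster : ∀ {a f t i} → cen f i ≡ i → home i ≡ f → centre (a , f) (t , i) ≡ (a ⊓ t , i)
  centre-cluster {a} {f} {t} {i} c h with centre (a , f) (t , i) | centreView a f t i
  ... | _ | leaf ¬c     = ⊥-elim (¬c c)
  ... | _ | cluster _ _ = refl
  ... | _ | own _ ¬h    = ⊥-elim (¬h h)

  centre-at-centre : ∀ {a f s i} → cen f i ≡ i → (home i ≡ f → a ⊓ s ≡ s) → centre (a , f) (s , i) ≡ (s , i)
  centre-at-centre {a} {f} {s} {i} c a⊓s≡s with centre (a , f) (s , i) | centreView a f s i
  ... | _ | leaf ¬c     = ⊥-elim (¬c c)
  ... | _ | cluster _ h = cong (_, i) (a⊓s≡s h)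
  ... | _ | own _ _     = refl

  centre-idem : ∀ w x → centre w (centre w x) ≡ centre w x
  centre-idem (a , f) (t , i) with centre (a , f) (t , i) | centreView a f t i
  ... | _ | leaf _       = centre-at-centre (cen-idem f i) (λ _ → ⊓-idem a)
  ... | _ | cluster c _  = centre-at-centre c (λ _ → trans (sym (⊓-assoc a a t)) (cong (_⊓ t) (⊓-idem a)))
  ... | _ | own c ¬h     = centre-at-centre c (λ h → ⊥-elim (¬h h))

  colour-cluster : ∀ t u i → colour (t , i) (u , i) ≡ (t ⊓ u , home i)
  colour-cluster t u i with colour (t , i) (u , i) | colourView t i u i
  ... | _ | cluster _  = refl
  ... | _ | to-j i≢i _ = ⊥-elim (i≢i refl)
  ... | _ | to-i i≢i _ = ⊥-elim (i≢i refl)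

  colour-to-centre : ∀ {t i u j} → i ≢ j → cen (col i j) i ≡ j → colour (t , i) (u , j) ≡ (u , col i j)
  colour-to-centre {t} {i} {u} {j} i≢j cen-i≡j with colour (t , i) (u , j) | colourView t i u j
  ... | _ | cluster i≡j      = ⊥-elim (i≢j i≡j)
  ... | _ | to-j _ _         = refl
  ... | _ | to-i _ cen-j≡i   = ⊥-elim (not-both i≢j cen-i≡j cen-j≡i)

  colour-sym : ∀ x y → colour x y ≡ colour y x
  colour-sym (t , i) (u , j)
    with colour (t , i) (u , j) | colourView t i u j | colour (u , j) (t , i) | colourView u j t i
  ... | _ | cluster refl | _ | cluster _ = cong (_, home i) (⊓-comm t u)
  ... | _ | cluster i≡j | _ | to-j j≢i _ = ⊥-elim (j≢i (sym i≡j))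
  ... | _ | cluster i≡j | _ | to-i j≢i _ = ⊥-elim (j≢i (sym i≡j))
  ... | _ | to-j i≢j _ | _ | cluster j≡i = ⊥-elim (i≢j (sym j≡i))
  ... | _ | to-i i≢j _ | _ | cluster j≡i = ⊥-elim (i≢j (sym j≡i))
  ... | _ | to-j _ _ | _ | to-i _ _ = cong (u ,_) (col-sym i j)
  ... | _ | to-i _ _ | _ | to-j _ _ = cong (t ,_) (col-sym i j)
  ... | _ | to-j i≢j cen-i≡j | _ | to-j _ cen-j≡i =
    ⊥-elim (not-both i≢j cen-i≡j (subst (λ F → cen F j ≡ i) (col-sym j i) cen-j≡i))
  ... | _ | to-i i≢j cen-j≡i | _ | to-i _ cen-i≡j =
    ⊥-elim (not-both i≢j (subst (λ F → cen F i ≡ j) (col-sym j i) cen-i≡j) cen-j≡i)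

  colour⇒star : ∀ x y → centre (colour x y) x ≡ y ⊎ centre (colour x y) y ≡ x
  colour⇒star (t , i) (u , j) with colour (t , i) (u , j) | colourView t i u j
  ... | _ | cluster refl with ⊓-sel t u
  ...   | inj₁ t⊓u≡t = inj₂ (trans (centre-cluster (home-centre i) refl)
          (cong (_, i) (trans (⊓-absorbʳ t u) t⊓u≡t)))
  ...   | inj₂ t⊓u≡u = inj₁ (trans (centre-cluster (home-centre i) refl) (cong (_, i)
          (trans (cong (_⊓ t) (⊓-comm t u)) (trans (⊓-absorbʳ u t) (trans (⊓-comm u t) t⊓u≡u)))))
  colour⇒star (t , i) (u , j) | _ | to-j i≢j cen-i≡j =
    inj₁ (trans (centre-leaf (λ c → i≢j (trans (sym c) cen-i≡j))) (cong (u ,_) cen-i≡j))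
  colour⇒star (t , i) (u , j) | _ | to-i i≢j cen-j≡i =
    inj₂ (trans (centre-leaf (λ c → i≢j (trans (sym cen-j≡i) c))) (cong (t ,_) cen-j≡i))

  centre⇒colour : ∀ w x → x ≢ centre w x → colour x (centre w x) ≡ w
  centre⇒colour (a , f) (t , i) x≢centre with centre (a , f) (t , i) | centreView a f t i
  ... | _ | leaf ¬c =
    trans (colour-to-centre i≢c (subst (λ F → cen F i ≡ cen f i) (sym col≡f) refl)) (cong (a ,_) col≡f)
    where
    i≢c : i ≢ cen f i
    i≢c i≡c = ¬c (sym i≡c)
    col≡f : col i (cen f i) ≡ f
    col≡f = proj₂ (proj₂ (proj₂ (star f) i (cen f i)) (i≢c , inj₁ refl))
  ... | _ | cluster _ h = trans (colour-cluster t (a ⊓ t) i) (cong₂ _,_ t⊓[a⊓t]≡a h)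
    where
    a⊓t≡a : a ⊓ t ≡ a
    a⊓t≡a = ⊓≢ʳ⇒≡ˡ (λ a⊓t≡t → x≢centre (cong (_, i) (sym a⊓t≡t)))
    t⊓[a⊓t]≡a : t ⊓ (a ⊓ t) ≡ a
    t⊓[a⊓t]≡a = trans (cong (t ⊓_) a⊓t≡a) (trans (⊓-comm t a) a⊓t≡a)
  ... | _ | own _ _ = ⊥-elim (x≢centre refl)

  isStarForest : ∀ w → IsStarForestWith′ (ColourClass′ colour w) (centre w)
  isStarForest w = isStarForest-of-centres {col = colour} {cen = centre} colour-sym (centre-idem w)
    (λ x y _ colour≡w → subst (λ w → centre w x ≡ y ⊎ centre w y ≡ x) colour≡w (colour⇒star x y))
    (λ x y x≢y centre≡y → subst (λ y → colour x y ≡ w) centre≡y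
      (centre⇒colour w x (subst (x ≢_) (sym centre≡y) x≢y)))

  data LeafEdgeIn (a : Fin k) (f : W) : Vertex → Vertex → Set where
    original : ∀ {t i} → cen f i ≢ i → LeafEdgeIn a f (t , i) (a , cen f i)
    cluster  : ∀ {t i} → cen f i ≡ i → a Fin.< t → LeafEdgeIn a f (t , i) (a , i)

  leafEdgeIn : ∀ a f x → x ≢ centre (a , f) x → LeafEdgeIn a f x (centre (a , f) x)
  leafEdgeIn a f (t , i) x≢centre with centre (a , f) (t , i) | centreView a f t i
  ... | _ | leaf ¬c     = original ¬c
  ... | _ | cluster c _ = subst (λ s → LeafEdgeIn a f (t , i) (s , i)) (sym a⊓t≡a) (cluster c a<t)
    where
    a⊓t≡a : a ⊓ t ≡ a
    a⊓t≡a = ⊓≢ʳ⇒≡ˡ (λ a⊓t≡t → x≢centre (cong (_, i) (sym a⊓t≡t)))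
    a<t : a Fin.< t
    a<t = Finₚ.≤∧≢⇒< (subst (Fin._≤ t) a⊓t≡a (x⊓y≤y a t))
      (λ a≡t → x≢centre (cong (_, i) (trans (sym a≡t) (sym a⊓t≡a))))
  ... | _ | own _ _     = ⊥-elim (x≢centre refl)

module GeometricBlowUp {n m : ℕ} (P : Fin n → Point) (gp : GeneralPosition P)
  (col : Fin n → Fin n → Fin m) (cen : Fin m → Fin n → Fin n)
  (sfp : StarForestPartition P m col cen) (home : EveryVertexACenter cen) (k : ℕ) where

  open import Data.Fin using (_≟_)
  open import Data.Rational using (_*_; _-_)

  star : ∀ f → IsStarForestWith (ColourClass col f) (cen f)
  star f = proj₁ (proj₂ sfp f)

  open BlowUp _≟_ _≟_ k col cen (proj₁ sfp) star (proj₁ ∘ home) (proj₂ ∘ home) public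

  _≟ᵛ_ : DecidableEquality Vertex
  _≟ᵛ_ = ≡-dec _≟_ _≟_

  points : ℚ → Vertex → Point
  points ε (t , i) = perturb ε (P i) (radius t)

  private
    P≢ : ∀ {i j} → i ≢ j → P i ≢ P j
    P≢ = proj₁ gp _ _

    copy-≢ : ∀ {t u : Fin k} {i : Fin n} → (t , i) ≢ (u , i) → t ≢ u
    copy-≢ ne t≡u = ne (cong (_, _) t≡u)

    Δ≢0 : ∀ {t u i} → (t , i) ≢ (u , i) → radius u - radius t ≢ 0ℚ
    Δ≢0 ne = p≢q⇒p-q≢0 (mono-<⇒injective radius-< (≢-sym (copy-≢ ne)))

    Δ²≢0 : ∀ {t u i} → (t , i) ≢ (u , i) → radius t * radius t - radius u * radius u ≢ 0ℚ
    Δ²≢0 ne = p≢q⇒p-q≢0 (mono-<⇒injective radius²-< (copy-≢ ne))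

  eventually-injective : ∀ x y → Eventually (λ ε → x ≢ y → points ε x ≢ points ε y)
  eventually-injective x@(t , i) y@(u , j) = eventually-→ (¬? (x ≟ᵛ y)) (injective (i ≟ j))
    where
    injective : Dec (i ≡ j) → x ≢ y → Eventually (λ ε → points ε x ≢ points ε y)
    injective (yes refl) x≢y = eventually-always (λ ε 0<ε →
      perturb-injectiveʳ (P i) (radius t) (radius u) 0<ε (mono-<⇒injective radius²-< (copy-≢ x≢y)))
    injective (no i≢j) _ = eventually-perturb-≢ (P i) (P j) (radius t) (radius u) (P≢ i≢j)

  eventually-orient≢0 : ∀ x y z →
    Eventually (λ ε → x ≢ y × y ≢ z × x ≢ z → orient (points ε x) (points ε y) (points ε z) ≢ 0ℚ)
  eventually-orient≢0 x@(t₁ , i₁) y@(t₂ , i₂) z@(t₃ , i₃) =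
    eventually-→ (¬? (x ≟ᵛ y) ×-dec ¬? (y ≟ᵛ z) ×-dec ¬? (x ≟ᵛ z))
      (λ (x≢y , y≢z , x≢z) → cases (i₁ ≟ i₂) (i₂ ≟ i₃) (i₁ ≟ i₃) x≢y y≢z x≢z)
    where
    cases : Dec (i₁ ≡ i₂) → Dec (i₂ ≡ i₃) → Dec (i₁ ≡ i₃) → x ≢ y → y ≢ z → x ≢ z →
      Eventually (λ ε → orient (points ε x) (points ε y) (points ε z) ≢ 0ℚ)
    cases (yes refl) (yes refl) _ x≢y y≢z x≢z =
      eventually-orient≢0-perturb-thrice (P i₁) (radius t₁) (radius t₂) (radius t₃) (Δ≢0 x≢y) (Δ≢0 x≢z) (Δ≢0 y≢z)
    cases (yes refl) (no i₂≢i₃) _ x≢y _ _ =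
      eventually-orient≢0-perturb-twice (P i₁) (P i₃) (radius t₁) (radius t₂) (radius t₃)
        (P≢ i₂≢i₃) (Δ≢0 x≢y) (Δ²≢0 x≢y)
    cases (no i₁≢i₂) (yes refl) _ _ y≢z _ = eventually-map
      (λ ε _ yzx≢0 xyz≡0 → yzx≢0 (trans (sym (orient-rotate (points ε x) (points ε y) (points ε z))) xyz≡0))
      (eventually-orient≢0-perturb-twice (P i₂) (P i₁) (radius t₂) (radius t₃) (radius t₁)
        (P≢ (≢-sym i₁≢i₂)) (Δ≢0 y≢z) (Δ²≢0 y≢z))
    cases (no i₁≢i₂) (no _) (yes refl) _ _ x≢z = eventually-map
      (λ ε _ zxy≢0 xyz≡0 → zxy≢0 (trans (sym (orient-rotate (points ε y) (points ε z) (points ε x)))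
        (trans (sym (orient-rotate (points ε x) (points ε y) (points ε z))) xyz≡0)))
      (eventually-orient≢0-perturb-twice (P i₁) (P i₂) (radius t₃) (radius t₁) (radius t₂)
        (P≢ i₁≢i₂) (Δ≢0 (≢-sym x≢z)) (Δ²≢0 (≢-sym x≢z)))
    cases (no i₁≢i₂) (no i₂≢i₃) (no i₁≢i₃) _ _ _ = eventually-orient≢0-perturb (P i₁) (P i₂) (P i₃)
      (radius t₁) (radius t₂) (radius t₃) (orient≢0 gp i₁≢i₂ i₂≢i₃ i₁≢i₃)

  eventually-separated-leafEdges : ∀ {a f l₁ c₁ l₂ c₂} → LeafEdgeIn a f l₁ c₁ → LeafEdgeIn a f l₂ c₂ → c₁ ≢ c₂ →
    Eventually (λ ε → Separated (points ε l₁) (points ε c₁) (points ε l₂) (points ε c₂))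
  eventually-separated-leafEdges {a} {f} (original {t₁} {j₁} ¬c₁) (original {t₂} {j₂} ¬c₂) c₁≢c₂ =
    eventually-separated-perturb (radius t₁) (radius a) (radius t₂) (radius a)
      (leafEdgesSeparated-of-plane gp (star f) (proj₂ (proj₂ sfp f)) j₁ j₂ (≢-sym ¬c₁) (≢-sym ¬c₂)
        (λ c₁≡c₂ → c₁≢c₂ (cong (a ,_) c₁≡c₂)))
  eventually-separated-leafEdges {a} {f} (original {t₁} {j₁} ¬c₁) (cluster {t₂} {j₂} c₂ _) c₁≢c₂ =
    eventually-separated-perturb (radius t₁) (radius a) (radius t₂) (radius a)
      (inj₁ (sameSide-of-orient≢0 (P j₁) (P (cen f j₁)) (P j₂) (orient≢0 gp (≢-sym ¬c₁)
        (λ c≡j₂ → c₁≢c₂ (cong (a ,_) c≡j₂)) (λ j₁≡j₂ → ¬c₁ (trans (cong (cen f) j₁≡j₂) (trans c₂ (sym j₁≡j₂)))))))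
  eventually-separated-leafEdges {a} {f} (cluster {t₁} {j₁} c₁ _) (original {t₂} {j₂} ¬c₂) c₁≢c₂ =
    eventually-separated-perturb (radius t₁) (radius a) (radius t₂) (radius a)
      (inj₂ (sameSide-of-orient≢0 (P j₂) (P (cen f j₂)) (P j₁) (orient≢0 gp (≢-sym ¬c₂)
        (λ c≡j₁ → c₁≢c₂ (cong (a ,_) (sym c≡j₁))) (λ j₂≡j₁ → ¬c₂ (trans (cong (cen f) j₂≡j₁) (trans c₁ (sym j₂≡j₁)))))))
  eventually-separated-leafEdges {a} (cluster {t₁} {j₁} _ a<t₁) (cluster {t₂} {j₂} _ _) c₁≢c₂ =
    eventually-map (λ _ _ → inj₁)
      (eventually-sameSide-cluster (P j₁) (P j₂) (radius a) (radius t₁) (P≢ (λ j₁≡j₂ → c₁≢c₂ (cong (a ,_) j₁≡j₂)))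
        (p<q⇒0<q-p (radius-< a<t₁)) (p<q⇒0<q-p (radius²-< a<t₁)) (radius t₂) (radius a))

  eventually-leafEdgesSeparated : ∀ w l₁ l₂ → Eventually (λ ε →
    l₁ ≢ centre w l₁ × l₂ ≢ centre w l₂ × centre w l₁ ≢ centre w l₂ →
    Separated (points ε l₁) (points ε (centre w l₁)) (points ε l₂) (points ε (centre w l₂)))
  eventually-leafEdgesSeparated w@(a , f) l₁ l₂ =
    eventually-→ (¬? (l₁ ≟ᵛ centre w l₁) ×-dec ¬? (l₂ ≟ᵛ centre w l₂) ×-dec ¬? (centre w l₁ ≟ᵛ centre w l₂))
      (λ (leaf₁ , leaf₂ , c₁≢c₂) →
        eventually-separated-leafEdges (leafEdgeIn a f l₁ leaf₁) (leafEdgeIn a f l₂ leaf₂) c₁≢c₂)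

  GoodPerturbation : ℚ → Set
  GoodPerturbation ε = GeneralPosition′ (points ε) × ∀ w → LeafEdgesSeparated (points ε) (centre w)

  eventually-good : Eventually GoodPerturbation
  eventually-good = eventually-map
    (λ _ _ (injective , nonCollinear , separated) →
      (injective , λ x y z x≢y y≢z x≢z xyz → nonCollinear x y z (x≢y , y≢z , x≢z) (collinear⇒orient≡0 _ _ _ xyz)) ,
      λ w l₁ l₂ leaf₁ leaf₂ c₁≢c₂ → separated w l₁ l₂ (leaf₁ , leaf₂ , c₁≢c₂))
    (eventually-× (∀ᵛ λ x → ∀ᵛ λ y → eventually-injective x y)
      (eventually-× (∀ᵛ λ x → ∀ᵛ λ y → ∀ᵛ λ z → eventually-orient≢0 x y z)
        (eventually-∀Fin× k m λ w → ∀ᵛ λ l₁ → ∀ᵛ λ l₂ → eventually-leafEdgesSeparated w l₁ l₂)))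
    where
    ∀ᵛ : ∀ {Q : Vertex → ℚ → Set} → (∀ x → Eventually (Q x)) → Eventually (λ ε → ∀ x → Q x ε)
    ∀ᵛ = eventually-∀Fin× k n

  starForestPartition-at : ∀ {ε} → GoodPerturbation ε → StarForestPartition′ (points ε) colour centre
  starForestPartition-at (gp′ , separated) = colour-sym , λ w → isStarForest w ,
    plane-⊆ (λ {x} {y} → proj₁ (proj₂ (isStarForest w) x y)) (plane-of-leafEdgesSeparated gp′ _≟ᵛ_ (separated w))

open import Data.Nat using (_*_; _<_; _≤_)

theorem2 : (n₀ m : ℕ) → 1 ≤ n₀ → n₀ < 2 * m → m < n₀ →
    (Σ (Fin n₀ → Point) λ P → GeneralPosition P ×
      Σ (Fin n₀ → Fin n₀ → Fin m) λ col → Σ (Fin m → Fin n₀ → Fin n₀) λ cen →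
        StarForestPartition P m col cen × EveryVertexACenter cen) →
    (k : ℕ) → 1 ≤ k →
    Σ (Fin (k * n₀) → Point) λ P → GeneralPosition P ×
      Σ (Fin (k * n₀) → Fin (k * n₀) → Fin (k * m)) λ col →
        Σ (Fin (k * m) → Fin (k * n₀) → Fin (k * n₀)) λ cen →
          StarForestPartition P (k * m) col cen
theorem2 n₀ m _ _ _ (P , gp , col , cen , partition , home) k _ =
  _ , relabel-generalPosition *↔× (proj₁ good) ,
  _ , _ , relabel-starForestPartition *↔× *↔× (starForestPartition-at {ε} good)
  where
  open GeometricBlowUp P gp col cen partition home k
  ε : ℚ
  ε = proj₁ (eventually-witness eventually-good)
  good : GoodPerturbation ε
  good = proj₂ (eventually-witness eventually-good)
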